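{- Take any integer $\ell \in [0, n-2]$. Then $\mathbb{E}[\Delta_{\ell} f(\pi)\mid\pi\in \mathrm{PPF}_n]=1.$ Moreover, $\mathbb{E}[{\mathrm{des}}(\pi)\mid\pi\in\mathrm{PPF}_n]=\mathbb{E}[\mathrm{asc}(\pi)\mid\pi\in\mathrm{PPF}_n]=\frac{n-2}{2}.$
   Context: A parking function of length $n$ is a sequence of positive integers whose increasing rearrangement $\lambda$ satisfies $\lambda_i\le i$; it is prime if removing any instance of 1 yields a parking function of length $n-1$. $\mathrm{PPF}_n$ denotes the set of prime parking functions of length $n$, with $\pi$ chosen uniformly at random. A tuple $(x_1,\dots,x_n)$ has an $\ell$-forward difference at $i\in[n-1]$ if $x_{i+1}-x_i\equiv\ell\pmod{n-1}$; $\Delta_\ell f(\pi)$ counts these. $\mathrm{des}(\pi)=|\{i\in[n-1]:\pi_i>\pi_{i+1}\}|$ and $\mathrm{asc}(\pi)=|\{i\in[n-1]:\pi_i<\pi_{i+1}\}|$. -}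

module Defs where

open import Data.Bool using (_≟_; Bool; true; false; _∧_; if_then_else_)
open import Data.Nat using (ℕ; zero; suc; _+_; _∸_; _≤ᵇ_; _<ᵇ_; _≡ᵇ_)
open import Data.Nat.Divisibility using (_∣?_)
open import Data.Integer using (ℤ; +_; _-_; ∣_∣)
open import Data.List using (List; []; _∷_; length; map; concatMap; filter; upTo; _++_)
open import Data.Nat.ListAction using (sum)
open import Data.Bool.ListAction using (and; all)
open import Data.Rational using (ℚ; 0ℚ) renaming (_/_ to _÷_)
open import Relation.Nullary.Decidable using (does)
open import Relation.Binary.PropositionalEquality using (_≡_)

tuples : ℕ → ℕ → List (List ℕ)
tuples n zero    = [] ∷ []
tuples n (suc k) = concatMap (λ x → map (x ∷_) (tuples n k)) (map suc (upTo n))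

insert : ℕ → List ℕ → List ℕ
insert x []       = x ∷ []
insert x (y ∷ ys) = if x ≤ᵇ y then x ∷ y ∷ ys else y ∷ insert x ys

sort : List ℕ → List ℕ
sort []       = []
sort (x ∷ xs) = insert x (sort xs)

bounded : ℕ → List ℕ → Bool
bounded i []       = true
bounded i (x ∷ xs) = (x ≤ᵇ i) ∧ bounded (suc i) xs

isPF : List ℕ → Bool
isPF xs = all (λ x → 1 ≤ᵇ x) xs ∧ bounded 1 (sort xs)

removeOnes : List ℕ → List (List ℕ)
removeOnes []       = []
removeOnes (x ∷ xs) =
  (if x ≡ᵇ 1 then xs ∷ [] else []) ++ map (x ∷_) (removeOnes xs)

isPPF : List ℕ → Bool
isPPF xs = isPF xs ∧ and (map isPF (removeOnes xs))

-- PPF_n as an explicit (duplicate-free) list.  Every parking function of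
-- length n has entries in {1,…,n}, so filtering [n]^n gives all of PPF_n.
PPF : ℕ → List (List ℕ)
PPF n = filter (λ xs → isPPF xs ≟ true) (tuples n n)

countAdj : (ℕ → ℕ → Bool) → List ℕ → ℕ
countAdj P []           = 0
countAdj P (x ∷ [])     = 0
countAdj P (x ∷ y ∷ xs) = (if P x y then 1 else 0) + countAdj P (y ∷ xs)

congMod : ℕ → ℤ → ℤ → Bool
congMod m a b = does (m ∣? ∣ a - b ∣)

Δ : ℕ → List ℕ → ℕ
Δ ℓ xs = countAdj (λ a b → congMod (length xs ∸ 1) (+ b - + a) (+ ℓ)) xs

des : List ℕ → ℕ
des = countAdj (λ a b → b <ᵇ a)

asc : List ℕ → ℕ
asc = countAdj (λ a b → a <ᵇ b)

-- expectation of f for a uniformly random element of a finite list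
-- (0 for the empty list, which never arises below)
𝔼 : {A : Set} → List A → (A → ℕ) → ℚ
𝔼 []         f = 0ℚ
𝔼 xs@(_ ∷ _) f = (+ sum (map f xs)) ÷ length xs

-- Write m = n - 1. A prime parking function of length n has its entries in [1, m], and a word
-- x ∈ [1, m]ⁿ is one iff #{i | xᵢ ≤ t + 1} ≥ t + 2 for all t < m, i.e. iff every proper prefix of
-- its count vector (#{i | xᵢ = v}) for v = 1, …, m, whose entries sum to m + 1, has sum exceeding
-- its length. Relabelling the values by v ↦ v - 1 (mod m) rotates the count vector, so by the
-- cycle lemma exactly one of the m relabellings of each word is a prime parking function; hence
-- m · Σ_{PPF_n} g = Σ_{[1,m]ⁿ} g for every relabelling-invariant statistic g. For g = 1 this gives
-- |PPF_n| = mᵐ. The statistic Δ_ℓ is invariant, and every letter has exactly one successor in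
-- [1, m] at difference ℓ mod m, so Σ_{[1,m]ⁿ} Δ_ℓ = m · mᵐ and the mean of Δ_ℓ is 1. Finally
-- des + asc + Δ₀ = n - 1 on [1, m]ⁿ, and reversal preserves PPF_n while exchanging des and asc,
-- so both have mean (n - 2)/2.

module Submission where

open import Defs
open import Data.Bool using (Bool; true; false; if_then_else_; _∧_) renaming (_≟_ to _≟ᵇ_)
open import Data.Bool.Properties using (T-≡; ∧-conicalˡ; ∧-conicalʳ)
open import Data.Nat
  using (ℕ; zero; suc; _+_; _*_; _^_; _∸_; _≤_; _<_; z≤n; s≤s; s≤s⁻¹; z<s; s<s; _≤ᵇ_; _<ᵇ_; _≡ᵇ_; >-nonZero)
open import Data.Nat.Properties
open import Data.Nat.ListAction using (sum)
open import Data.Nat.ListAction.Properties using (sum-++; sum-↭)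
open import Data.List
  using (List; []; _∷_; _++_; _∷ʳ_; length; map; concatMap; filter; upTo; applyUpTo; take; drop; reverse)
open import Data.List.Properties
  using (map-++; map-∘; map-upTo; applyUpTo-∷ʳ; unfold-reverse; take-take; take-all; take-[]; take++drop≡id; length-drop;
         length-map; length-applyUpTo; ++-assoc; ++-identityʳ)
open import Data.List.Relation.Unary.All as All using (All; []; _∷_)
open import Data.List.Relation.Unary.All.Properties using (++⁺; All¬⇒¬Any) renaming (map⁺ to All-map⁺)
open import Data.List.Relation.Unary.Any using (Any; here; there)
open import Data.List.Relation.Unary.Linked as Linked using (Linked; []; [-]; _∷_)
open import Data.List.Relation.Unary.Linked.Properties using (Linked⇒All)
open import Data.List.Relation.Binary.Permutation.Propositional using (_↭_; ↭-refl; ↭-trans; prep; swap)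
open import Data.List.Relation.Binary.Permutation.Propositional.Properties using (map⁺; ↭-length; All-resp-↭; ↭-reverse)
open import Data.List.Membership.Propositional using (_∈_)
open import Data.List.Membership.Propositional.Properties using (∈-++⁺ʳ; ∈-map⁺)
import Data.List.Sort.InsertionSort.Base ≤-decTotalOrder as InsertionSort
open import Data.List.Sort.InsertionSort.Properties ≤-decTotalOrder
  renaming (sort-↭ to insertionSort-↭; sort-↗ to insertionSort-↗)
open import Data.Bool.ListAction using (all)
open import Data.Empty using (⊥-elim)
open import Data.Nat.GeneralisedArithmetic using (fold)
open import Data.Sum using (inj₁; inj₂)
open import Data.Product using (_×_; _,_; proj₁; proj₂; ∃₂; ∃-syntax)
open import Function using (_∘_; _⇔_; mk⇔; Equivalence)
open import Function.Properties.Equivalence using () renaming (sym to ⇔-sym; trans to ⇔-trans)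
open import Relation.Binary.PropositionalEquality
open import Relation.Nullary using (¬_; yes; no)
open import Relation.Binary.Definitions using (tri<; tri≈; tri>)
open import Data.Nat.Tactic.RingSolver using (solve-∀)

open ≡-Reasoning

∑< : ℕ → (ℕ → ℕ) → ℕ
∑< m f = sum (applyUpTo f m)

syntax ∑< m (λ i → e) = ∑[ i < m ] e

∑<-cong : ∀ m {f g : ℕ → ℕ} → (∀ i → i < m → f i ≡ g i) → ∑< m f ≡ ∑< m g
∑<-cong zero    eq = refl
∑<-cong (suc m) eq = cong₂ _+_ (eq 0 z<s) (∑<-cong m (λ i i<m → eq (suc i) (s<s i<m)))

∑<-suc : ∀ m f → ∑< (suc m) f ≡ ∑< m f + f m
∑<-suc m f = begin
  sum (applyUpTo f (suc m))        ≡⟨ cong sum (applyUpTo-∷ʳ f m) ⟨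
  sum (applyUpTo f m ∷ʳ f m)       ≡⟨ sum-++ (applyUpTo f m) (f m ∷ []) ⟩
  ∑< m f + (f m + 0)               ≡⟨ cong (∑< m f +_) (+-identityʳ (f m)) ⟩
  ∑< m f + f m                     ∎

∑<-const : ∀ m c → ∑[ i < m ] c ≡ m * c
∑<-const zero    c = refl
∑<-const (suc m) c = cong (c +_) (∑<-const m c)

∑<-zero : ∀ m {f} → (∀ i → i < m → f i ≡ 0) → ∑< m f ≡ 0
∑<-zero m eq = trans (∑<-cong m eq) (trans (∑<-const m 0) (*-zeroʳ m))

∑<-distrib-+ : ∀ m (f g : ℕ → ℕ) → ∑[ i < m ] (f i + g i) ≡ ∑< m f + ∑< m g
∑<-distrib-+ zero    f g = refl
∑<-distrib-+ (suc m) f g = begin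
  f 0 + g 0 + ∑[ i < m ] (f (suc i) + g (suc i))
    ≡⟨ cong (f 0 + g 0 +_) (∑<-distrib-+ m (f ∘ suc) (g ∘ suc)) ⟩
  f 0 + g 0 + (∑< m (f ∘ suc) + ∑< m (g ∘ suc))
    ≡⟨ +-assoc-middle (f 0) (g 0) _ _ ⟩
  f 0 + ∑< m (f ∘ suc) + (g 0 + ∑< m (g ∘ suc)) ∎
  where
  +-assoc-middle : ∀ a b c d → a + b + (c + d) ≡ a + c + (b + d)
  +-assoc-middle = solve-∀

∑<-distribʳ-* : ∀ m (f : ℕ → ℕ) c → ∑[ i < m ] (f i * c) ≡ ∑< m f * c
∑<-distribʳ-* zero    f c = refl
∑<-distribʳ-* (suc m) f c =
  trans (cong (f 0 * c +_) (∑<-distribʳ-* m (f ∘ suc) c)) (sym (*-distribʳ-+ c (f 0) _))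

∑<-comm : ∀ m k (f : ℕ → ℕ → ℕ) → ∑[ i < m ] ∑[ j < k ] f i j ≡ ∑[ j < k ] ∑[ i < m ] f i j
∑<-comm zero    k f = sym (∑<-zero k (λ _ _ → refl))
∑<-comm (suc m) k f = begin
  ∑[ j < k ] f 0 j + ∑[ i < m ] ∑[ j < k ] f (suc i) j
    ≡⟨ cong (∑[ j < k ] f 0 j +_) (∑<-comm m k (f ∘ suc)) ⟩
  ∑[ j < k ] f 0 j + ∑[ j < k ] ∑[ i < m ] f (suc i) j
    ≡⟨ ∑<-distrib-+ k (f 0) (λ j → ∑[ i < m ] f (suc i) j) ⟨
  ∑[ j < k ] ∑[ i < suc m ] f i j ∎

∑<-truncate : ∀ {M} N (f : ℕ → ℕ) → M ≤ N → (∀ i → M ≤ i → i < N → f i ≡ 0) → ∑< N f ≡ ∑< M f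
∑<-truncate {M} N f M≤N vanish with m≤n⇒m<n∨m≡n M≤N
... | inj₂ refl = refl
... | inj₁ M<N@(s≤s {n = N′} M≤N′) = begin
  ∑< N f              ≡⟨ ∑<-suc N′ f ⟩
  ∑< N′ f + f N′      ≡⟨ cong₂ _+_ (∑<-truncate N′ f M≤N′ (λ i M≤i i<N′ → vanish i M≤i (m<n⇒m<1+n i<N′)))
                                    (vanish N′ M≤N′ ≤-refl) ⟩
  ∑< M f + 0          ≡⟨ +-identityʳ _ ⟩
  ∑< M f              ∎

𝟙 : Bool → ℕ
𝟙 b = if b then 1 else 0

𝟙-false : ∀ {b} → ¬ b ≡ true → 𝟙 b ≡ 0
𝟙-false {false} _    = refl
𝟙-false {true}  b≢tt = ⊥-elim (b≢tt refl)

∑<-𝟙-unique : ∀ m (p : ℕ → Bool) {k} → k < m → p k ≡ true → (∀ i → i < m → p i ≡ true → i ≡ k) →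
              ∑[ i < m ] 𝟙 (p i) ≡ 1
∑<-𝟙-unique (suc m) p {zero}  _         pk uniq =
  cong₂ _+_ (cong 𝟙 pk) (∑<-zero m (λ i i<m → 𝟙-false (λ pi → 1+n≢0 (uniq (suc i) (s<s i<m) pi))))
∑<-𝟙-unique (suc m) p {suc k} (s<s k<m) pk uniq =
  cong₂ _+_ (𝟙-false (λ p0 → 0≢1+n (uniq 0 z<s p0)))
            (∑<-𝟙-unique m (p ∘ suc) k<m pk (λ i i<m pi → suc-injective (uniq (suc i) (s<s i<m) pi)))

≡-true-ext : ∀ {a b : Bool} → (a ≡ true → b ≡ true) → (b ≡ true → a ≡ true) → a ≡ b
≡-true-ext {false} {false} _ _ = refl
≡-true-ext {false} {true}  _ g = g refl
≡-true-ext {true}  {false} f _ = sym (f refl)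
≡-true-ext {true}  {true}  _ _ = refl

≤ᵇ-true : ∀ {m n} → m ≤ n → (m ≤ᵇ n) ≡ true
≤ᵇ-true m≤n = Equivalence.to T-≡ (≤⇒≤ᵇ m≤n)

≤ᵇ-true⁻¹ : ∀ m n → (m ≤ᵇ n) ≡ true → m ≤ n
≤ᵇ-true⁻¹ m n eq = ≤ᵇ⇒≤ m n (Equivalence.from T-≡ eq)

≤ᵇ-false : ∀ {m n} → n < m → (m ≤ᵇ n) ≡ false
≤ᵇ-false {m} {n} n<m with m ≤ᵇ n in eq
... | true  = ⊥-elim (<⇒≱ n<m (≤ᵇ-true⁻¹ m n eq))
... | false = refl

≤ᵇ-false⁻¹ : ∀ m n → (m ≤ᵇ n) ≡ false → n < m
≤ᵇ-false⁻¹ m n eq = ≰⇒> (λ m≤n → true≢false (trans (sym (≤ᵇ-true m≤n)) eq))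
  where
  true≢false : true ≢ false
  true≢false ()

<ᵇ-true : ∀ {m n} → m < n → (m <ᵇ n) ≡ true
<ᵇ-true m<n = Equivalence.to T-≡ (<⇒<ᵇ m<n)

<ᵇ-false : ∀ {m n} → n ≤ m → (m <ᵇ n) ≡ false
<ᵇ-false {m} {n} n≤m with m <ᵇ n in eq
... | true  = ⊥-elim (<⇒≱ (<ᵇ⇒< m n (Equivalence.from T-≡ eq)) n≤m)
... | false = refl

≡ᵇ-true : ∀ {m n} → m ≡ n → (m ≡ᵇ n) ≡ true
≡ᵇ-true {m} {n} m≡n = Equivalence.to T-≡ (≡⇒≡ᵇ m n m≡n)

≡ᵇ-true⁻¹ : ∀ m n → (m ≡ᵇ n) ≡ true → m ≡ n
≡ᵇ-true⁻¹ m n eq = ≡ᵇ⇒≡ m n (Equivalence.from T-≡ eq)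

≡ᵇ-false : ∀ {m n} → m ≢ n → (m ≡ᵇ n) ≡ false
≡ᵇ-false {m} {n} m≢n with m ≡ᵇ n in eq
... | true  = ⊥-elim (m≢n (≡ᵇ-true⁻¹ m n eq))
... | false = refl

restrict : {A : Set} → (A → Bool) → (A → ℕ) → A → ℕ
restrict p g x = if p x then g x else 0

restrict-𝟙 : ∀ {A : Set} (p : A → Bool) g x → restrict p g x ≡ 𝟙 (p x) * g x
restrict-𝟙 p g x with p x
... | true  = sym (+-identityʳ (g x))
... | false = refl

sum-map-filter : ∀ {A : Set} (p : A → Bool) (g : A → ℕ) xs →
                 sum (map g (filter (λ x → p x ≟ᵇ true) xs)) ≡ sum (map (restrict p g) xs)
sum-map-filter p g []       = refl
sum-map-filter p g (x ∷ xs) with p x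
... | true  = cong (g x +_) (sum-map-filter p g xs)
... | false = sum-map-filter p g xs

sum-map-concatMap : ∀ {A B : Set} (F : B → ℕ) (g : A → List B) xs →
                    sum (map F (concatMap g xs)) ≡ sum (map (λ a → sum (map F (g a))) xs)
sum-map-concatMap F g []       = refl
sum-map-concatMap F g (x ∷ xs) = begin
  sum (map F (g x ++ concatMap g xs))                ≡⟨ cong sum (map-++ F (g x) (concatMap g xs)) ⟩
  sum (map F (g x) ++ map F (concatMap g xs))        ≡⟨ sum-++ (map F (g x)) _ ⟩
  sum (map F (g x)) + sum (map F (concatMap g xs))   ≡⟨ cong (sum (map F (g x)) +_) (sum-map-concatMap F g xs) ⟩
  sum (map (λ a → sum (map F (g a))) (x ∷ xs))       ∎

sum-map-+ : ∀ {A : Set} (f g : A → ℕ) xs → sum (map (λ x → f x + g x) xs) ≡ sum (map f xs) + sum (map g xs)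
sum-map-+ f g []       = refl
sum-map-+ f g (x ∷ xs) = begin
  f x + g x + sum (map (λ x → f x + g x) xs)         ≡⟨ cong (f x + g x +_) (sum-map-+ f g xs) ⟩
  f x + g x + (sum (map f xs) + sum (map g xs))      ≡⟨ +-assoc-middle (f x) (g x) _ _ ⟩
  f x + sum (map f xs) + (g x + sum (map g xs))      ∎
  where
  +-assoc-middle : ∀ a b c d → a + b + (c + d) ≡ a + c + (b + d)
  +-assoc-middle = solve-∀

sum-map-const : ∀ {A : Set} c (xs : List A) → sum (map (λ _ → c) xs) ≡ c * length xs
sum-map-const c []       = sym (*-zeroʳ c)
sum-map-const c (x ∷ xs) = trans (cong (λ t → c + t) (sum-map-const c xs)) (sym (*-suc c (length xs)))

InRange : ℕ → ℕ → Set
InRange N v = 1 ≤ v × v ≤ N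

tupleSum : ℕ → ℕ → (List ℕ → ℕ) → ℕ
tupleSum N k F = sum (map F (tuples N k))

tupleSum-∷ : ∀ N k F → tupleSum N (suc k) F ≡ ∑[ i < N ] tupleSum N k (λ y → F (suc i ∷ y))
tupleSum-∷ N k F = begin
  sum (map F (concatMap (λ a → map (a ∷_) (tuples N k)) (map suc (upTo N))))
    ≡⟨ sum-map-concatMap F _ (map suc (upTo N)) ⟩
  sum (map (λ a → sum (map F (map (a ∷_) (tuples N k)))) (map suc (upTo N)))
    ≡⟨ cong sum (trans (sym (map-∘ (upTo N))) (map-upTo _ N)) ⟩
  ∑[ i < N ] sum (map F (map (suc i ∷_) (tuples N k)))
    ≡⟨ ∑<-cong N (λ i _ → cong sum (sym (map-∘ (tuples N k)))) ⟩
  ∑[ i < N ] tupleSum N k (λ y → F (suc i ∷ y)) ∎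

tupleSum-cong : ∀ N k {F G : List ℕ → ℕ} → (∀ x → All (InRange N) x → length x ≡ k → F x ≡ G x) →
                tupleSum N k F ≡ tupleSum N k G
tupleSum-cong N zero    eq = cong (_+ 0) (eq [] [] refl)
tupleSum-cong N (suc k) {F} {G} eq = begin
  tupleSum N (suc k) F                             ≡⟨ tupleSum-∷ N k F ⟩
  ∑[ i < N ] tupleSum N k (λ y → F (suc i ∷ y))    ≡⟨ ∑<-cong N (λ i i<N → tupleSum-cong N k (λ x x∈ ∣x∣ →
                                                         eq (suc i ∷ x) ((s≤s z≤n , i<N) ∷ x∈) (cong suc ∣x∣))) ⟩
  ∑[ i < N ] tupleSum N k (λ y → G (suc i ∷ y))    ≡⟨ tupleSum-∷ N k G ⟨
  tupleSum N (suc k) G                             ∎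

tupleSum-const : ∀ N k c → tupleSum N k (λ _ → c) ≡ c * N ^ k
tupleSum-const N zero    c = trans (+-identityʳ c) (sym (*-identityʳ c))
tupleSum-const N (suc k) c = begin
  tupleSum N (suc k) (λ _ → c)     ≡⟨ tupleSum-∷ N k _ ⟩
  ∑[ i < N ] tupleSum N k (λ _ → c) ≡⟨ ∑<-cong N (λ i _ → tupleSum-const N k c) ⟩
  ∑[ i < N ] (c * N ^ k)           ≡⟨ ∑<-const N _ ⟩
  N * (c * N ^ k)                  ≡⟨ *-left-comm N c (N ^ k) ⟩
  c * (N * N ^ k)                  ∎
  where
  *-left-comm : ∀ a b d → a * (b * d) ≡ b * (a * d)
  *-left-comm = solve-∀

tupleSum-zero : ∀ N k {F} → (∀ x → All (InRange N) x → length x ≡ k → F x ≡ 0) → tupleSum N k F ≡ 0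
tupleSum-zero N k vanish = trans (tupleSum-cong N k vanish) (tupleSum-const N k 0)

tupleSum-∑< : ∀ N k m (G : ℕ → List ℕ → ℕ) →
              tupleSum N k (λ x → ∑[ j < m ] G j x) ≡ ∑[ j < m ] tupleSum N k (G j)
tupleSum-∑< N k zero    G = tupleSum-const N k 0
tupleSum-∑< N k (suc m) G = trans (sum-map-+ (G 0) (λ x → ∑[ j < m ] G (suc j) x) (tuples N k))
                                  (cong (tupleSum N k (G 0) +_) (tupleSum-∑< N k m (G ∘ suc)))

tupleSum-∷ʳ : ∀ N k F → tupleSum N (suc k) F ≡ ∑[ i < N ] tupleSum N k (λ y → F (y ∷ʳ suc i))
tupleSum-∷ʳ N zero    F = tupleSum-∷ N 0 F
tupleSum-∷ʳ N (suc k) F = begin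
  tupleSum N (suc (suc k)) F
    ≡⟨ tupleSum-∷ N (suc k) F ⟩
  ∑[ i < N ] tupleSum N (suc k) (λ y → F (suc i ∷ y))
    ≡⟨ ∑<-cong N (λ i _ → tupleSum-∷ʳ N k (λ y → F (suc i ∷ y))) ⟩
  ∑[ i < N ] ∑[ j < N ] tupleSum N k (λ y → F (suc i ∷ y ∷ʳ suc j))
    ≡⟨ ∑<-comm N N _ ⟩
  ∑[ j < N ] ∑[ i < N ] tupleSum N k (λ y → F (suc i ∷ y ∷ʳ suc j))
    ≡⟨ ∑<-cong N (λ j _ → tupleSum-∷ N k (λ z → F (z ∷ʳ suc j))) ⟨
  ∑[ j < N ] tupleSum N (suc k) (λ z → F (z ∷ʳ suc j)) ∎

tupleSum-reverse : ∀ N k F → tupleSum N k (F ∘ reverse) ≡ tupleSum N k F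
tupleSum-reverse N zero    F = refl
tupleSum-reverse N (suc k) F = begin
  tupleSum N (suc k) (F ∘ reverse)
    ≡⟨ tupleSum-∷ N k _ ⟩
  ∑[ i < N ] tupleSum N k (λ y → F (reverse (suc i ∷ y)))
    ≡⟨ ∑<-cong N (λ i _ → tupleSum-cong N k (λ y _ _ → cong F (unfold-reverse (suc i) y))) ⟩
  ∑[ i < N ] tupleSum N k (λ y → F (reverse y ∷ʳ suc i))
    ≡⟨ ∑<-cong N (λ i _ → tupleSum-reverse N k (λ y → F (y ∷ʳ suc i))) ⟩
  ∑[ i < N ] tupleSum N k (λ y → F (y ∷ʳ suc i))
    ≡⟨ tupleSum-∷ʳ N k F ⟨
  tupleSum N (suc k) F ∎

tupleSum-map-permutation : ∀ N k (σ : ℕ → ℕ) →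
                           (∀ (H : ℕ → ℕ) → ∑[ i < N ] H (σ (suc i)) ≡ ∑[ i < N ] H (suc i)) →
                           ∀ F → tupleSum N k (F ∘ map σ) ≡ tupleSum N k F
tupleSum-map-permutation N zero    σ perm F = refl
tupleSum-map-permutation N (suc k) σ perm F = begin
  tupleSum N (suc k) (F ∘ map σ)
    ≡⟨ tupleSum-∷ N k _ ⟩
  ∑[ i < N ] tupleSum N k (λ y → F (σ (suc i) ∷ map σ y))
    ≡⟨ ∑<-cong N (λ i _ → tupleSum-map-permutation N k σ perm (λ y → F (σ (suc i) ∷ y))) ⟩
  ∑[ i < N ] tupleSum N k (λ y → F (σ (suc i) ∷ y))
    ≡⟨ perm (λ v → tupleSum N k (λ y → F (v ∷ y))) ⟩
  ∑[ i < N ] tupleSum N k (λ y → F (suc i ∷ y))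
    ≡⟨ tupleSum-∷ N k F ⟨
  tupleSum N (suc k) F ∎

tupleSum-shrink : ∀ {M} N k F → M ≤ N →
                  (∀ x → All (InRange N) x → length x ≡ k → Any (M <_) x → F x ≡ 0) →
                  tupleSum N k F ≡ tupleSum M k F
tupleSum-shrink     N zero    F M≤N vanish = refl
tupleSum-shrink {M} N (suc k) F M≤N vanish = begin
  tupleSum N (suc k) F
    ≡⟨ tupleSum-∷ N k F ⟩
  ∑[ i < N ] tupleSum N k (λ y → F (suc i ∷ y))
    ≡⟨ ∑<-cong N (λ i i<N → tupleSum-shrink N k _ M≤N (λ x x∈ ∣x∣ large →
         vanish (suc i ∷ x) ((s≤s z≤n , i<N) ∷ x∈) (cong suc ∣x∣) (there large))) ⟩
  ∑[ i < N ] tupleSum M k (λ y → F (suc i ∷ y))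
    ≡⟨ ∑<-truncate N _ M≤N (λ i M≤i i<N → tupleSum-zero M k (λ x x∈ ∣x∣ →
         vanish (suc i ∷ x) ((s≤s z≤n , i<N) ∷ All.map (λ (1≤v , v≤M) → 1≤v , ≤-trans v≤M M≤N) x∈)
                (cong suc ∣x∣) (here (s≤s M≤i)))) ⟩
  ∑[ i < M ] tupleSum M k (λ y → F (suc i ∷ y))
    ≡⟨ tupleSum-∷ M k F ⟨
  tupleSum M (suc k) F ∎

-- Parking functions and prime parking functions

count : (ℕ → Bool) → List ℕ → ℕ
count p xs = sum (map (𝟙 ∘ p) xs)

count-↭ : ∀ p {xs ys} → xs ↭ ys → count p xs ≡ count p ys
count-↭ p xs↭ys = sum-↭ (map⁺ (𝟙 ∘ p) xs↭ys)

count-cong : ∀ {P : ℕ → Set} {p q : ℕ → Bool} x → All P x → (∀ {v} → P v → p v ≡ q v) →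
             count p x ≡ count q x
count-cong []       []           _    = refl
count-cong (v ∷ x) (pv ∷ px) p≡q = cong₂ _+_ (cong 𝟙 (p≡q pv)) (count-cong x px p≡q)

count-map : ∀ p f x → count p (map f x) ≡ count (p ∘ f) x
count-map p f x = cong sum (sym (map-∘ x))

#≤ : ℕ → List ℕ → ℕ
#≤ j = count (_≤ᵇ j)

#≤≤length : ∀ j xs → #≤ j xs ≤ length xs
#≤≤length j []       = z≤n
#≤≤length j (x ∷ xs) with x ≤ᵇ j
... | true  = s≤s (#≤≤length j xs)
... | false = m≤n⇒m≤1+n (#≤≤length j xs)

#≤-all : ∀ {j} xs → All (_≤ j) xs → #≤ j xs ≡ length xs
#≤-all []       []             = refl
#≤-all (x ∷ xs) (x≤j ∷ xs≤j) rewrite ≤ᵇ-true x≤j = cong suc (#≤-all xs xs≤j)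

#≤-all⁻¹ : ∀ j xs → length xs ≤ #≤ j xs → All (_≤ j) xs
#≤-all⁻¹ j []       _ = []
#≤-all⁻¹ j (x ∷ xs) full with x ≤ᵇ j in x≤ᵇj
... | true  = ≤ᵇ-true⁻¹ x j x≤ᵇj ∷ #≤-all⁻¹ j xs (s≤s⁻¹ full)
... | false = ⊥-elim (<-irrefl refl (≤-trans full (#≤≤length j xs)))

#≤-none : ∀ {j} xs → All (j <_) xs → #≤ j xs ≡ 0
#≤-none []       []             = refl
#≤-none (x ∷ xs) (j<x ∷ j<xs) rewrite ≤ᵇ-false j<x = #≤-none xs j<xs

all< : ℕ → (ℕ → Bool) → Bool
all< zero    f = true
all< (suc L) f = f 0 ∧ all< L (f ∘ suc)

all<-cong : ∀ L {f g : ℕ → Bool} → (∀ t → t < L → f t ≡ g t) → all< L f ≡ all< L g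
all<-cong zero    eq = refl
all<-cong (suc L) eq = cong₂ _∧_ (eq 0 z<s) (all<-cong L (λ t t<L → eq (suc t) (s<s t<L)))

all<-true : ∀ L {f : ℕ → Bool} → (∀ t → t < L → f t ≡ true) → all< L f ≡ true
all<-true zero    holds = refl
all<-true (suc L) holds = cong₂ _∧_ (holds 0 z<s) (all<-true L (λ t t<L → holds (suc t) (s<s t<L)))

all<-true⁻¹ : ∀ L {f : ℕ → Bool} → all< L f ≡ true → ∀ t → t < L → f t ≡ true
all<-true⁻¹ (suc L) {f} eq zero    _         = ∧-conicalˡ (f 0) _ eq
all<-true⁻¹ (suc L) {f} eq (suc t) (s<s t<L) = all<-true⁻¹ L (∧-conicalʳ (f 0) _ eq) t t<L

all-true : ∀ {A : Set} {p : A → Bool} xs → All (λ v → p v ≡ true) xs → all p xs ≡ true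
all-true []       []           = refl
all-true (x ∷ xs) (px ∷ pxs) = cong₂ _∧_ px (all-true xs pxs)

all-true⁻¹ : ∀ {A : Set} (p : A → Bool) xs → all p xs ≡ true → All (λ v → p v ≡ true) xs
all-true⁻¹ p []       _   = []
all-true⁻¹ p (x ∷ xs) eq = ∧-conicalˡ (p x) _ eq ∷ all-true⁻¹ p xs (∧-conicalʳ (p x) _ eq)

sort-≡ : ∀ xs → sort xs ≡ InsertionSort.sort xs
sort-≡ []       = refl
sort-≡ (x ∷ xs) = trans (insert-≡ (sort xs)) (cong (InsertionSort.insert x) (sort-≡ xs))
  where
  insert-≡ : ∀ ys → insert x ys ≡ InsertionSort.insert x ys
  insert-≡ []       = refl
  insert-≡ (y ∷ ys) = cong (if x ≤ᵇ y then x ∷ y ∷ ys else_) (cong (y ∷_) (insert-≡ ys))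

Sorted : List ℕ → Set
Sorted = Linked _≤_

sort-↗ : ∀ xs → Sorted (sort xs)
sort-↗ xs = subst Sorted (sym (sort-≡ xs)) (insertionSort-↗ xs)

sort-↭ : ∀ xs → sort xs ↭ xs
sort-↭ xs = subst (_↭ xs) (sym (sort-≡ xs)) (insertionSort-↭ xs)

sorted-head : ∀ {y s} → Sorted (y ∷ s) → All (y ≤_) s
sorted-head [-]         = []
sorted-head (y≤z ∷ s↗) = Linked⇒All ≤-trans y≤z s↗

bounded-sorted : ∀ i s → Sorted s → bounded i s ≡ all< (length s) (λ t → suc t ≤ᵇ #≤ (i + t) s)
bounded-sorted i []      _   = refl
bounded-sorted i (y ∷ s) y∷s↗ with y ≤ᵇ i in y≤ᵇi
... | false = cong (λ c → (1 ≤ᵇ c) ∧ all< (length s) (λ t → suc (suc t) ≤ᵇ #≤ (i + suc t) (y ∷ s)))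
                   (sym (#≤-none (y ∷ s) (i+0<y ∷ All.map (<-≤-trans i+0<y) (sorted-head y∷s↗))))
  where
  i+0<y : i + 0 < y
  i+0<y = subst (_< y) (sym (+-identityʳ i)) (≤ᵇ-false⁻¹ y i y≤ᵇi)
... | true  = begin
  bounded (suc i) s
    ≡⟨ bounded-sorted (suc i) s (Linked.tail y∷s↗) ⟩
  all< (length s) (λ t → suc t ≤ᵇ #≤ (suc i + t) s)
    ≡⟨ all<-cong (length s) (λ t _ → cong (λ j → suc t ≤ᵇ #≤ j s) (sym (+-suc i t))) ⟩
  all< (length s) (λ t → suc (suc t) ≤ᵇ suc (#≤ (i + suc t) s))
    ≡⟨ all<-cong (length s) (λ t _ → cong (suc (suc t) ≤ᵇ_) (#≤-head (suc t))) ⟨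
  all< (length s) (λ t → suc (suc t) ≤ᵇ #≤ (i + suc t) (y ∷ s))
    ≡⟨ cong (λ c → (1 ≤ᵇ c) ∧ all< (length s) (λ t → suc (suc t) ≤ᵇ #≤ (i + suc t) (y ∷ s))) (#≤-head 0) ⟨
  all< (suc (length s)) (λ t → suc t ≤ᵇ #≤ (i + t) (y ∷ s)) ∎
  where
  #≤-head : ∀ t → #≤ (i + t) (y ∷ s) ≡ suc (#≤ (i + t) s)
  #≤-head t = cong (λ b → 𝟙 b + #≤ (i + t) s) (≤ᵇ-true (≤-trans (≤ᵇ-true⁻¹ y i y≤ᵇi) (m≤m+n i t)))

parkingᵇ : List ℕ → Bool
parkingᵇ xs = all< (length xs) (λ t → suc t ≤ᵇ #≤ (suc t) xs)

isPF≡parkingᵇ : ∀ xs → isPF xs ≡ all (1 ≤ᵇ_) xs ∧ parkingᵇ xs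
isPF≡parkingᵇ xs = cong (all (1 ≤ᵇ_) xs ∧_) (begin
  bounded 1 (sort xs)
    ≡⟨ bounded-sorted 1 (sort xs) (sort-↗ xs) ⟩
  all< (length (sort xs)) (λ t → suc t ≤ᵇ #≤ (suc t) (sort xs))
    ≡⟨ cong (λ L → all< L (λ t → suc t ≤ᵇ #≤ (suc t) (sort xs))) (↭-length (sort-↭ xs)) ⟩
  all< (length xs) (λ t → suc t ≤ᵇ #≤ (suc t) (sort xs))
    ≡⟨ all<-cong (length xs) (λ t _ → cong (suc t ≤ᵇ_) (count-↭ (_≤ᵇ suc t) (sort-↭ xs))) ⟩
  parkingᵇ xs ∎)

isPF⇒#≤ : ∀ xs → isPF xs ≡ true → ∀ t → t < length xs → suc t ≤ #≤ (suc t) xs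
isPF⇒#≤ xs pf t t<L = ≤ᵇ-true⁻¹ _ _ (all<-true⁻¹ (length xs) parking t t<L)
  where
  parking : parkingᵇ xs ≡ true
  parking = ∧-conicalʳ (all (1 ≤ᵇ_) xs) _ (trans (sym (isPF≡parkingᵇ xs)) pf)

#≤⇒isPF : ∀ xs → All (1 ≤_) xs → (∀ t → t < length xs → suc t ≤ #≤ (suc t) xs) → isPF xs ≡ true
#≤⇒isPF xs pos parking = trans (isPF≡parkingᵇ xs)
  (cong₂ _∧_ (all-true xs (All.map ≤ᵇ-true pos)) (all<-true (length xs) (λ t t<L → ≤ᵇ-true (parking t t<L))))

removeOnes-↭ : ∀ xs → All (λ ys → xs ↭ 1 ∷ ys) (removeOnes xs)
removeOnes-↭ []       = []
removeOnes-↭ (x ∷ xs) =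
  ++⁺ removeHead (All-map⁺ (All.map (λ xs↭ → ↭-trans (prep x xs↭) (swap x 1 ↭-refl)) (removeOnes-↭ xs)))
  where
  removeHead : All (λ ys → x ∷ xs ↭ 1 ∷ ys) (if x ≡ᵇ 1 then xs ∷ [] else [])
  removeHead with x ≡ᵇ 1 in x≡ᵇ1
  ... | false = []
  ... | true rewrite ≡ᵇ-true⁻¹ x 1 x≡ᵇ1 = ↭-refl ∷ []

removeOnes-nonempty : ∀ {xs} → Any (_≡ 1) xs → ∃[ ys ] ys ∈ removeOnes xs
removeOnes-nonempty {x ∷ xs} (here refl)   = xs , here refl
removeOnes-nonempty {x ∷ xs} (there 1∈xs) with removeOnes-nonempty 1∈xs
... | ys , ys∈ = x ∷ ys , ∈-++⁺ʳ (if x ≡ᵇ 1 then xs ∷ [] else []) (∈-map⁺ (x ∷_) ys∈)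

#≤1-pos⇒1∈ : ∀ xs → All (1 ≤_) xs → 0 < #≤ 1 xs → Any (_≡ 1) xs
#≤1-pos⇒1∈ (x ∷ xs) (1≤x ∷ pos) has≤1 with x ≤ᵇ 1 in x≤ᵇ1
... | true  = here (≤-antisym (≤ᵇ-true⁻¹ x 1 x≤ᵇ1) 1≤x)
... | false = there (#≤1-pos⇒1∈ xs pos has≤1)

primeᵇ : ℕ → List ℕ → Bool
primeᵇ m x = all< m (λ t → 2 + t ≤ᵇ #≤ (suc t) x)

primeᵇ-true : ∀ m x → (∀ t → t < m → 2 + t ≤ #≤ (suc t) x) → primeᵇ m x ≡ true
primeᵇ-true m x prime = all<-true m (λ t t<m → ≤ᵇ-true (prime t t<m))

primeᵇ-true⁻¹ : ∀ m x → primeᵇ m x ≡ true → ∀ t → t < m → 2 + t ≤ #≤ (suc t) x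
primeᵇ-true⁻¹ m x prime t t<m = ≤ᵇ-true⁻¹ _ _ (all<-true⁻¹ m {λ t → 2 + t ≤ᵇ #≤ (suc t) x} prime t t<m)

isPPF⇒primeᵇ : ∀ m x → All (1 ≤_) x → length x ≡ suc m → isPPF x ≡ true → primeᵇ m x ≡ true
isPPF⇒primeᵇ m x pos ∣x∣ ppf =
  primeᵇ-true m x (λ t t<m → subst (2 + t ≤_) (sym (count-↭ (_≤ᵇ suc t) x↭1∷ys))
                                   (s≤s (isPF⇒#≤ ys ys-PF t (subst (t <_) ∣ys∣ t<m))))
  where
  1∈x : Any (_≡ 1) x
  1∈x = #≤1-pos⇒1∈ x pos (isPF⇒#≤ x (∧-conicalˡ (isPF x) _ ppf) 0 (subst (0 <_) (sym ∣x∣) z<s))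
  ys : List ℕ
  ys = proj₁ (removeOnes-nonempty 1∈x)
  ys∈ : ys ∈ removeOnes x
  ys∈ = proj₂ (removeOnes-nonempty 1∈x)
  x↭1∷ys : x ↭ 1 ∷ ys
  x↭1∷ys = All.lookup (removeOnes-↭ x) ys∈
  ys-PF : isPF ys ≡ true
  ys-PF = All.lookup (all-true⁻¹ isPF (removeOnes x) (∧-conicalʳ (isPF x) _ ppf)) ys∈
  ∣ys∣ : m ≡ length ys
  ∣ys∣ = suc-injective (trans (sym ∣x∣) (↭-length x↭1∷ys))

primeᵇ⇒isPPF : ∀ m x → All (InRange m) x → length x ≡ suc m → primeᵇ m x ≡ true → isPPF x ≡ true
primeᵇ⇒isPPF m x x∈ ∣x∣ prime =
  cong₂ _∧_ (#≤⇒isPF x pos parking) (all-true (removeOnes x) (All.map removal-PF (removeOnes-↭ x)))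
  where
  pos : All (1 ≤_) x
  pos = All.map proj₁ x∈
  prime-at : ∀ t → t < m → 2 + t ≤ #≤ (suc t) x
  prime-at = primeᵇ-true⁻¹ m x prime
  parking : ∀ t → t < length x → suc t ≤ #≤ (suc t) x
  parking t t<L with m≤n⇒m<n∨m≡n (s≤s⁻¹ (subst (t <_) ∣x∣ t<L))
  ... | inj₁ t<m  = ≤-trans (n≤1+n _) (prime-at t t<m)
  ... | inj₂ refl = ≤-reflexive (sym (trans (#≤-all x (All.map (m≤n⇒m≤1+n ∘ proj₂) x∈)) ∣x∣))
  removal-PF : ∀ {ys} → x ↭ 1 ∷ ys → isPF ys ≡ true
  removal-PF {ys} x↭1∷ys = #≤⇒isPF ys (All.tail (All-resp-↭ x↭1∷ys pos)) (λ t t<L →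
    s≤s⁻¹ (subst (2 + t ≤_) (count-↭ (_≤ᵇ suc t) x↭1∷ys) (prime-at t (subst (t <_) ∣ys∣ t<L))))
    where
    ∣ys∣ : length ys ≡ m
    ∣ys∣ = suc-injective (trans (sym (↭-length x↭1∷ys)) ∣x∣)

isPPF≡primeᵇ : ∀ m x → All (InRange m) x → length x ≡ suc m → isPPF x ≡ primeᵇ m x
isPPF≡primeᵇ m x x∈ ∣x∣ =
  ≡-true-ext (isPPF⇒primeᵇ m x (All.map proj₁ x∈) ∣x∣) (primeᵇ⇒isPPF m x x∈ ∣x∣)

primeᵇ⇒≤ : ∀ m x → length x ≡ suc (suc m) → primeᵇ (suc m) x ≡ true → All (_≤ suc m) x
primeᵇ⇒≤ m x ∣x∣ prime = #≤-all⁻¹ (suc m) x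
  (subst (_≤ #≤ (suc m) x) (sym ∣x∣) (primeᵇ-true⁻¹ (suc m) x prime m ≤-refl))

primeᵇ-reverse : ∀ m x → primeᵇ m (reverse x) ≡ primeᵇ m x
primeᵇ-reverse m x = all<-cong m (λ t _ → cong (2 + t ≤ᵇ_) (count-↭ (_≤ᵇ suc t) (↭-reverse x)))

-- The cycle lemma

≤-⇔-+ˡ : ∀ a {x y x′ y′} → a + x ≡ x′ → a + y ≡ y′ → (x ≤ y) ⇔ (x′ ≤ y′)
≤-⇔-+ˡ a refl refl = mk⇔ (+-monoʳ-≤ a) (+-cancelˡ-≤ a _ _)

take-++ˡ : ∀ {A : Set} j (xs ys : List A) → j ≤ length xs → take j (xs ++ ys) ≡ take j xs
take-++ˡ zero    xs       ys _         = refl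
take-++ˡ (suc j) (x ∷ xs) ys (s≤s j≤) = cong (x ∷_) (take-++ˡ j xs ys j≤)

take-++ʳ : ∀ {A : Set} (xs : List A) j ys → take (length xs + j) (xs ++ ys) ≡ xs ++ take j ys
take-++ʳ []       j ys = refl
take-++ʳ (x ∷ xs) j ys = cong (x ∷_) (take-++ʳ xs j ys)

take-+ : ∀ {A : Set} i j (xs : List A) → take (i + j) xs ≡ take i xs ++ take j (drop i xs)
take-+ zero    j xs       = refl
take-+ (suc i) j []       = sym (take-[] j)
take-+ (suc i) j (x ∷ xs) = cong (x ∷_) (take-+ i j xs)

rotate : ℕ → List ℕ → List ℕ
rotate k c = drop k c ++ take k c

rotate-one : List ℕ → List ℕ
rotate-one []       = []
rotate-one (y ∷ ys) = ys ∷ʳ y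

drop-∷ : ∀ k (c : List ℕ) → k < length c →
         ∃₂ λ v r → drop k c ≡ v ∷ r × drop (suc k) c ≡ r × take (suc k) c ≡ take k c ∷ʳ v
drop-∷ zero    (v ∷ c) _         = v , c , refl , refl , refl
drop-∷ (suc k) (y ∷ c) (s<s k<) with drop-∷ k c k<
... | v , r , drop-k , drop-suc-k , take-suc-k = v , r , drop-k , drop-suc-k , cong (y ∷_) take-suc-k

rotate-suc : ∀ k c → k < length c → rotate (suc k) c ≡ rotate-one (rotate k c)
rotate-suc k c k< with drop-∷ k c k<
... | v , r , drop-k , drop-suc-k , take-suc-k = begin
  drop (suc k) c ++ take (suc k) c    ≡⟨ cong₂ _++_ drop-suc-k take-suc-k ⟩
  r ++ (take k c ∷ʳ v)                ≡⟨ ++-assoc r (take k c) (v ∷ []) ⟨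
  rotate-one (v ∷ r ++ take k c)      ≡⟨ cong (λ d → rotate-one (d ++ take k c)) drop-k ⟨
  rotate-one (drop k c ++ take k c)   ∎

dominantᵇ : ℕ → List ℕ → Bool
dominantᵇ m d = all< m (λ t → 2 + t ≤ᵇ sum (take (suc t) d))

dominantᵇ-true : ∀ m d → (∀ t → t < m → 2 + t ≤ sum (take (suc t) d)) → dominantᵇ m d ≡ true
dominantᵇ-true m d dominant = all<-true m (λ t t<m → ≤ᵇ-true (dominant t t<m))

dominantᵇ-true⁻¹ : ∀ m d → dominantᵇ m d ≡ true → ∀ t → t < m → 2 + t ≤ sum (take (suc t) d)
dominantᵇ-true⁻¹ m d dom t t<m = ≤ᵇ-true⁻¹ _ _ (all<-true⁻¹ m {λ t → 2 + t ≤ᵇ sum (take (suc t) d)} dom t t<m)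

module CycleLemma (m : ℕ) (c : List ℕ) (∣c∣ : length c ≡ m) (Σc : sum c ≡ suc m) where

  S : ℕ → ℕ
  S j = sum (take j c)

  -- Q j = m + (S j - j): the walk with steps c₀ - 1, c₁ - 1, …, lifted by m to stay in ℕ.
  Q : ℕ → ℕ
  Q j = S j + (m ∸ j)

  Q-end : Q m ≡ suc m
  Q-end = begin
    S m + (m ∸ m)   ≡⟨ cong₂ _+_ (cong sum (take-all m c (≤-reflexive ∣c∣))) (n∸n≡0 m) ⟩
    sum c + 0       ≡⟨ +-identityʳ _ ⟩
    sum c           ≡⟨ Σc ⟩
    suc m           ∎

  S-+ : ∀ k j → S (k + j) ≡ S k + sum (take j (drop k c))
  S-+ k j = trans (cong sum (take-+ k j c)) (sum-++ (take k c) _)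

  m∸ : ∀ k u → m ≡ k + u → m ∸ k ≡ u
  m∸ k u refl = m+n∸m≡n k u

  ∣drop∣ : ∀ k u → m ≡ k + u → length (drop k c) ≡ u
  ∣drop∣ k u m≡ = trans (length-drop k c) (trans (cong (_∸ k) ∣c∣) (m∸ k u m≡))

  prefix-within : ∀ k t r → m ≡ k + suc t + r →
                  (2 + t ≤ sum (take (suc t) (rotate k c))) ⇔ (Q k < Q (k + suc t))
  prefix-within k t r m≡ = ≤-⇔-+ˡ (S k + r) e₁ e₂
    where
    m≡′ : m ≡ k + (suc t + r)
    m≡′ = trans m≡ (+-assoc k (suc t) r)
    X = sum (take (suc t) (drop k c))
    rotate-X : sum (take (suc t) (rotate k c)) ≡ X
    rotate-X = cong sum (take-++ˡ (suc t) (drop k c) (take k c)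
                 (subst (suc t ≤_) (sym (∣drop∣ k _ m≡′)) (m≤m+n (suc t) r)))
    e₁ : S k + r + (2 + t) ≡ suc (Q k)
    e₁ = trans (arrange (S k) r t) (cong (λ d → suc (S k + d)) (sym (m∸ k _ m≡′)))
      where
      arrange : ∀ a r t → a + r + (2 + t) ≡ suc (a + (suc t + r))
      arrange = solve-∀
    e₂ : S k + r + sum (take (suc t) (rotate k c)) ≡ Q (k + suc t)
    e₂ = begin
      S k + r + sum (take (suc t) (rotate k c))   ≡⟨ cong (S k + r +_) rotate-X ⟩
      S k + r + X                                 ≡⟨ +-right-comm (S k) r X ⟩
      S k + X + r                                 ≡⟨ cong₂ _+_ (S-+ k (suc t)) (m∸ (k + suc t) r m≡) ⟨
      Q (k + suc t)                               ∎
      where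
      +-right-comm : ∀ a b d → a + b + d ≡ a + d + b
      +-right-comm = solve-∀

  prefix-wrapping : ∀ k u s w → m ≡ k + u → k ≡ s + w →
                    (suc (u + s) ≤ sum (take (u + s) (rotate k c))) ⇔ (Q k ≤ Q s)
  prefix-wrapping k u s w m≡ k≡ = ⇔-trans (≤-⇔-+ˡ (w + u) e₁ e₂) (⇔-sym (≤-⇔-+ˡ D refl refl))
    where
    D = sum (drop k c)
    s≤k : s ≤ k
    s≤k = subst (s ≤_) (sym k≡) (m≤m+n s w)
    D+S : D + S k ≡ suc (s + w + u)
    D+S = begin
      D + S k                       ≡⟨ +-comm D (S k) ⟩
      S k + D                       ≡⟨ sum-++ (take k c) (drop k c) ⟨
      sum (take k c ++ drop k c)    ≡⟨ cong sum (take++drop≡id k c) ⟩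
      sum c                         ≡⟨ trans Σc (cong suc (trans m≡ (cong (_+ u) k≡))) ⟩
      suc (s + w + u)               ∎
    rotate-D+S : sum (take (u + s) (rotate k c)) ≡ D + S s
    rotate-D+S = begin
      sum (take (u + s) (rotate k c))                    ≡⟨ cong (λ L → sum (take (L + s) (rotate k c))) (∣drop∣ k u m≡) ⟨
      sum (take (length (drop k c) + s) (rotate k c))    ≡⟨ cong sum (take-++ʳ (drop k c) s (take k c)) ⟩
      sum (drop k c ++ take s (take k c))                ≡⟨ sum-++ (drop k c) _ ⟩
      D + sum (take s (take k c))                        ≡⟨ cong (λ xs → D + sum xs) (trans (take-take s k c)
                                                                (cong (λ j → take j c) (m≤n⇒m⊓n≡m s≤k))) ⟩
      D + S s                                            ∎
    e₁ : w + u + suc (u + s) ≡ D + Q k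
    e₁ = begin
      w + u + suc (u + s)    ≡⟨ arrange s w u ⟩
      suc (s + w + u) + u    ≡⟨ cong (_+ u) D+S ⟨
      D + S k + u            ≡⟨ +-assoc D (S k) u ⟩
      D + (S k + u)          ≡⟨ cong (λ d → D + (S k + d)) (m∸ k u m≡) ⟨
      D + Q k                ∎
      where
      arrange : ∀ s w u → w + u + suc (u + s) ≡ suc (s + w + u) + u
      arrange = solve-∀
    e₂ : w + u + sum (take (u + s) (rotate k c)) ≡ D + Q s
    e₂ = begin
      w + u + sum (take (u + s) (rotate k c))   ≡⟨ cong (w + u +_) rotate-D+S ⟩
      w + u + (D + S s)                         ≡⟨ arrange w u D (S s) ⟩
      D + (S s + (w + u))                       ≡⟨ cong (λ d → D + (S s + d)) (m∸ s (w + u) m≡′) ⟨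
      D + Q s                                   ∎
      where
      m≡′ : m ≡ s + (w + u)
      m≡′ = trans m≡ (trans (cong (_+ u) k≡) (+-assoc s w u))
      arrange : ∀ w u d a → w + u + (d + a) ≡ d + (a + (w + u))
      arrange = solve-∀

  IsLastMin : ℕ → ℕ → Set
  IsLastMin j k = k ≤ j × (∀ s → s ≤ j → Q k ≤ Q s) × (∀ s → k < s → s ≤ j → Q k < Q s)

  lastMin : ℕ → ℕ
  lastMin zero    = zero
  lastMin (suc j) = if Q (suc j) ≤ᵇ Q (lastMin j) then suc j else lastMin j

  lastMin-isLastMin : ∀ j → IsLastMin j (lastMin j)
  lastMin-isLastMin zero = z≤n , (λ { zero _ → ≤-refl }) , (λ s 0<s s≤0 → ⊥-elim (<⇒≱ 0<s s≤0))
  lastMin-isLastMin (suc j) with lastMin-isLastMin j | Q (suc j) ≤ᵇ Q (lastMin j) in new≤ᵇ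
  ... | _ , min , _ | true = ≤-refl , min′ , (λ s j<s s≤j → ⊥-elim (<⇒≱ j<s s≤j))
    where
    min′ : ∀ s → s ≤ suc j → Q (suc j) ≤ Q s
    min′ s s≤ with m≤n⇒m<n∨m≡n s≤
    ... | inj₁ s<  = ≤-trans (≤ᵇ-true⁻¹ _ _ new≤ᵇ) (min s (s≤s⁻¹ s<))
    ... | inj₂ refl = ≤-refl
  ... | k≤j , min , strict | false = m≤n⇒m≤1+n k≤j , min′ , strict′
    where
    old< : Q (lastMin j) < Q (suc j)
    old< = ≤ᵇ-false⁻¹ _ _ new≤ᵇ
    min′ : ∀ s → s ≤ suc j → Q (lastMin j) ≤ Q s
    min′ s s≤ with m≤n⇒m<n∨m≡n s≤
    ... | inj₁ s<  = min s (s≤s⁻¹ s<)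
    ... | inj₂ refl = <⇒≤ old<
    strict′ : ∀ s → lastMin j < s → s ≤ suc j → Q (lastMin j) < Q s
    strict′ s k<s s≤ with m≤n⇒m<n∨m≡n s≤
    ... | inj₁ s<  = strict s k<s (s≤s⁻¹ s<)
    ... | inj₂ refl = old<

  IsLastMin-unique : ∀ {j k k′} → IsLastMin j k → IsLastMin j k′ → k ≡ k′
  IsLastMin-unique {k = k} {k′} (k≤j , min , strict) (k′≤j , min′ , strict′) with <-cmp k k′
  ... | tri≈ _ k≡k′ _ = k≡k′
  ... | tri< k<k′ _ _ = ⊥-elim (<⇒≱ (strict k′ k<k′ k′≤j) (min′ k k≤j))
  ... | tri> _ _ k′<k = ⊥-elim (<⇒≱ (strict′ k k′<k k≤j) (min k′ k′≤j))

  IsLastMin-< : ∀ {k} → IsLastMin m k → k < m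
  IsLastMin-< {k} (k≤m , min , _) = ≤∧≢⇒< k≤m (λ { refl → <⇒≱ (subst (m <_) (sym Q-end) ≤-refl) (min 0 z≤n) })

  dominant⇒IsLastMin : ∀ {k} → k < m → dominantᵇ m (rotate k c) ≡ true → IsLastMin m k
  dominant⇒IsLastMin {k} k<m dom = <⇒≤ k<m , min , strict
    where
    prefix : ∀ t → t < m → 2 + t ≤ sum (take (suc t) (rotate k c))
    prefix = dominantᵇ-true⁻¹ m (rotate k c) dom
    strict : ∀ s → k < s → s ≤ m → Q k < Q s
    strict s k<s s≤m = subst (λ z → Q k < Q z) k+t≡s (Equivalence.to (prefix-within k t (m ∸ s) m≡) (prefix t t<m))
      where
      t = s ∸ suc k
      k+t≡s : k + suc t ≡ s
      k+t≡s = trans (+-suc k t) (m+[n∸m]≡n k<s)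
      m≡ : m ≡ k + suc t + (m ∸ s)
      m≡ = sym (trans (cong (_+ (m ∸ s)) k+t≡s) (m+[n∸m]≡n s≤m))
      t<m : t < m
      t<m = ≤-trans (m≤n+m (suc t) k) (subst (_≤ m) (sym k+t≡s) s≤m)
    min : ∀ s → s ≤ m → Q k ≤ Q s
    min s s≤m with <-cmp k s
    ... | tri< k<s _ _  = <⇒≤ (strict s k<s s≤m)
    ... | tri≈ _ refl _ = ≤-refl
    min zero    s≤m | tri> _ _ _   = s≤s⁻¹ (subst (Q k <_) Q-end (strict m k<m ≤-refl))
    min (suc s) s≤m | tri> _ _ s<k =
      Equivalence.to (prefix-wrapping k u (suc s) (k ∸ suc s) m≡k+u (sym (m+[n∸m]≡n (<⇒≤ s<k))))
        (subst (λ z → suc z ≤ sum (take z (rotate k c))) (sym (+-suc u s)) (prefix (u + s) u+s<m))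
      where
      u = m ∸ k
      m≡k+u : m ≡ k + u
      m≡k+u = sym (m+[n∸m]≡n (<⇒≤ k<m))
      u+s<m : u + s < m
      u+s<m = subst (u + s <_) (trans (+-comm u k) (sym m≡k+u)) (subst (_≤ u + k) (+-suc u s) (+-monoʳ-≤ u (<⇒≤ s<k)))

  IsLastMin⇒dominant : ∀ {k} → k < m → IsLastMin m k → dominantᵇ m (rotate k c) ≡ true
  IsLastMin⇒dominant {k} k<m (_ , min , strict) = dominantᵇ-true m (rotate k c) prefix
    where
    prefix : ∀ t → t < m → 2 + t ≤ sum (take (suc t) (rotate k c))
    prefix t t<m with k + suc t ≤? m
    ... | yes k+t≤m = Equivalence.from (prefix-within k t (m ∸ (k + suc t)) (sym (m+[n∸m]≡n k+t≤m)))
                        (strict (k + suc t) (m<m+n k z<s) k+t≤m)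
    ... | no  k+t≰m = subst (λ z → suc z ≤ sum (take z (rotate k c))) u+s≡
                        (Equivalence.from (prefix-wrapping k u s (k ∸ s) m≡k+u (sym (m+[n∸m]≡n s≤k)))
                          (min s (≤-trans s≤k (<⇒≤ k<m))))
      where
      u = m ∸ k
      s = k + suc t ∸ m
      m≡k+u : m ≡ k + u
      m≡k+u = sym (m+[n∸m]≡n (<⇒≤ k<m))
      k+t≡m+s : k + suc t ≡ m + s
      k+t≡m+s = sym (m+[n∸m]≡n (<⇒≤ (≰⇒> k+t≰m)))
      u+s≡ : u + s ≡ suc t
      u+s≡ = +-cancelˡ-≡ k (u + s) (suc t) (trans (sym (+-assoc k u s)) (trans (cong (_+ s) (sym m≡k+u)) (sym k+t≡m+s)))
      s≤k : s ≤ k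
      s≤k = +-cancelˡ-≤ u s k (subst (_≤ u + k) (sym u+s≡) (subst (suc t ≤_) (trans m≡k+u (+-comm k u)) t<m))

  unique-dominant-rotation : ∑[ k < m ] 𝟙 (dominantᵇ m (rotate k c)) ≡ 1
  unique-dominant-rotation =
    ∑<-𝟙-unique m (λ k → dominantᵇ m (rotate k c)) k₀<m (IsLastMin⇒dominant k₀<m k₀-lastMin)
                               (λ k k<m dom → IsLastMin-unique (dominant⇒IsLastMin k<m dom) k₀-lastMin)
    where
    k₀-lastMin : IsLastMin m (lastMin m)
    k₀-lastMin = lastMin-isLastMin m
    k₀<m : lastMin m < m
    k₀<m = IsLastMin-< k₀-lastMin

-- Value counts and the cyclic relabelling of values

counts : ℕ → List ℕ → List ℕ
counts m x = applyUpTo (λ i → count (suc i ≡ᵇ_) x) m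

take-applyUpTo : ∀ (g : ℕ → ℕ) {j m} → j ≤ m → take j (applyUpTo g m) ≡ applyUpTo g j
take-applyUpTo g z≤n       = refl
take-applyUpTo g (s≤s j≤m) = cong (g 0 ∷_) (take-applyUpTo (g ∘ suc) j≤m)

∑<-𝟙-≡ᵇ : ∀ j v → ∑[ i < j ] 𝟙 (i ≡ᵇ v) ≡ 𝟙 (v <ᵇ j)
∑<-𝟙-≡ᵇ zero    v       = refl
∑<-𝟙-≡ᵇ (suc j) zero    = cong suc (∑<-zero j (λ _ _ → refl))
∑<-𝟙-≡ᵇ (suc j) (suc v) = ∑<-𝟙-≡ᵇ j v

∑<-count-≡ᵇ : ∀ j x → All (1 ≤_) x → ∑[ i < j ] count (suc i ≡ᵇ_) x ≡ #≤ j x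
∑<-count-≡ᵇ j []          []          = ∑<-zero j (λ _ _ → refl)
∑<-count-≡ᵇ j (suc v ∷ x) (_ ∷ pos) =
  trans (∑<-distrib-+ j _ _) (cong₂ _+_ (∑<-𝟙-≡ᵇ j v) (∑<-count-≡ᵇ j x pos))

sum-take-counts : ∀ m x → All (1 ≤_) x → ∀ {j} → j ≤ m → sum (take j (counts m x)) ≡ #≤ j x
sum-take-counts m x pos j≤m = trans (cong sum (take-applyUpTo _ j≤m)) (∑<-count-≡ᵇ _ x pos)

length-counts : ∀ m x → length (counts m x) ≡ m
length-counts m x = length-applyUpTo _ m

sum-counts : ∀ m x → All (InRange m) x → sum (counts m x) ≡ length x
sum-counts m x x∈ = begin
  sum (counts m x)           ≡⟨ cong sum (take-all m (counts m x) (≤-reflexive (length-counts m x))) ⟨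
  sum (take m (counts m x))  ≡⟨ sum-take-counts m x (All.map proj₁ x∈) ≤-refl ⟩
  #≤ m x                     ≡⟨ #≤-all x (All.map proj₂ x∈) ⟩
  length x                   ∎

primeᵇ≡dominantᵇ-counts : ∀ m x → All (1 ≤_) x → primeᵇ m x ≡ dominantᵇ m (counts m x)
primeᵇ≡dominantᵇ-counts m x pos =
  all<-cong m (λ t t<m → cong (2 + t ≤ᵇ_) (sym (sum-take-counts m x pos t<m)))

shiftDown : ℕ → ℕ → ℕ
shiftDown m zero          = zero
shiftDown m (suc zero)    = m
shiftDown m (suc (suc v)) = suc v

shiftDown^ : ℕ → ℕ → List ℕ → List ℕ
shiftDown^ m k x = fold x (map (shiftDown m)) k

shiftDown-InRange : ∀ {m v} → InRange m v → InRange m (shiftDown m v)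
shiftDown-InRange {v = suc zero}    (_ , 1≤m)   = 1≤m , ≤-refl
shiftDown-InRange {v = suc (suc v)} (_ , v<m) = s≤s z≤n , <⇒≤ v<m

shiftDown^-InRange : ∀ m k {x} → All (InRange m) x → All (InRange m) (shiftDown^ m k x)
shiftDown^-InRange m zero    x∈ = x∈
shiftDown^-InRange m (suc k) x∈ = All-map⁺ (All.map shiftDown-InRange (shiftDown^-InRange m k x∈))

length-shiftDown^ : ∀ m k x → length (shiftDown^ m k x) ≡ length x
length-shiftDown^ m zero    x = refl
length-shiftDown^ m (suc k) x = trans (length-map (shiftDown m) (shiftDown^ m k x)) (length-shiftDown^ m k x)

∑<-shiftDown : ∀ m (H : ℕ → ℕ) → ∑[ i < m ] H (shiftDown m (suc i)) ≡ ∑[ i < m ] H (suc i)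
∑<-shiftDown zero    H = refl
∑<-shiftDown (suc m) H = trans (+-comm (H (suc m)) _) (sym (∑<-suc m (H ∘ suc)))

tupleSum-shiftDown^ : ∀ m n k F → tupleSum m n (F ∘ shiftDown^ m k) ≡ tupleSum m n F
tupleSum-shiftDown^ m n zero    F = refl
tupleSum-shiftDown^ m n (suc k) F =
  trans (tupleSum-shiftDown^ m n k (F ∘ map (shiftDown m)))
        (tupleSum-map-permutation m n (shiftDown m) (∑<-shiftDown m) F)

counts-shiftDown : ∀ m x → All (InRange m) x → counts m (map (shiftDown m) x) ≡ rotate-one (counts m x)
counts-shiftDown zero     x x∈ = refl
counts-shiftDown (suc m) x x∈ = begin
  applyUpTo (λ i → count (suc i ≡ᵇ_) (map σ x)) (suc m)
    ≡⟨ applyUpTo-∷ʳ _ m ⟨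
  applyUpTo (λ i → count (suc i ≡ᵇ_) (map σ x)) m ∷ʳ count (suc m ≡ᵇ_) (map σ x)
    ≡⟨ cong₂ _∷ʳ_ (applyUpTo-cong m (λ i i<m → trans (count-map _ σ x) (count-cong x x∈ (below i<m))))
                  (trans (count-map _ σ x) (count-cong x x∈ top)) ⟩
  applyUpTo (λ i → count (suc (suc i) ≡ᵇ_) x) m ∷ʳ count (1 ≡ᵇ_) x
    ∎
  where
  σ = shiftDown (suc m)
  applyUpTo-cong : ∀ j {f g : ℕ → ℕ} → (∀ i → i < j → f i ≡ g i) → applyUpTo f j ≡ applyUpTo g j
  applyUpTo-cong zero    _   = refl
  applyUpTo-cong (suc j) f≡g = cong₂ _∷_ (f≡g 0 z<s) (applyUpTo-cong j (λ i i<j → f≡g (suc i) (s<s i<j)))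
  below : ∀ {i} → i < m → ∀ {v} → InRange (suc m) v → (suc i ≡ᵇ σ v) ≡ (suc (suc i) ≡ᵇ v)
  below i<m {suc zero}    _ = ≡ᵇ-false (λ i≡m → <-irrefl (suc-injective i≡m) i<m)
  below i<m {suc (suc v)} _ = refl
  top : ∀ {v} → InRange (suc m) v → (suc m ≡ᵇ σ v) ≡ (1 ≡ᵇ v)
  top {suc zero}    _           = ≡ᵇ-true {m} refl
  top {suc (suc v)} (_ , s<s v<m) = ≡ᵇ-false (λ m≡v → <-irrefl (sym m≡v) v<m)

counts-shiftDown^ : ∀ m k x → All (InRange m) x → k ≤ m → counts m (shiftDown^ m k x) ≡ rotate k (counts m x)
counts-shiftDown^ m zero    x x∈ _   = sym (++-identityʳ (counts m x))
counts-shiftDown^ m (suc k) x x∈ k<m = begin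
  counts m (map (shiftDown m) (shiftDown^ m k x))    ≡⟨ counts-shiftDown m _ (shiftDown^-InRange m k x∈) ⟩
  rotate-one (counts m (shiftDown^ m k x))           ≡⟨ cong rotate-one (counts-shiftDown^ m k x x∈ (<⇒≤ k<m)) ⟩
  rotate-one (rotate k (counts m x))                 ≡⟨ rotate-suc k (counts m x) (subst (k <_) (sym (length-counts m x)) k<m) ⟨
  rotate (suc k) (counts m x)                        ∎

orbit-prime-unique : ∀ m x → All (InRange m) x → length x ≡ suc m →
                     ∑[ k < m ] 𝟙 (primeᵇ m (shiftDown^ m k x)) ≡ 1
orbit-prime-unique m x x∈ ∣x∣ = begin
  ∑[ k < m ] 𝟙 (primeᵇ m (shiftDown^ m k x))
    ≡⟨ ∑<-cong m (λ k k<m → cong 𝟙 (prime≡dominant k<m)) ⟩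
  ∑[ k < m ] 𝟙 (dominantᵇ m (rotate k (counts m x)))
    ≡⟨ CycleLemma.unique-dominant-rotation m (counts m x) (length-counts m x) (trans (sum-counts m x x∈) ∣x∣) ⟩
  1 ∎
  where
  prime≡dominant : ∀ {k} → k < m → primeᵇ m (shiftDown^ m k x) ≡ dominantᵇ m (rotate k (counts m x))
  prime≡dominant {k} k<m = trans (primeᵇ≡dominantᵇ-counts m _ (All.map proj₁ (shiftDown^-InRange m k x∈)))
                                 (cong (dominantᵇ m) (counts-shiftDown^ m k x x∈ (<⇒≤ k<m)))

ShiftInvariant : ℕ → (List ℕ → ℕ) → Set
ShiftInvariant m g = ∀ x → All (InRange m) x → length x ≡ suc m → g (map (shiftDown m) x) ≡ g x

tupleSum-restrict-primeᵇ : ∀ m g → ShiftInvariant m g →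
                           m * tupleSum m (suc m) (restrict (primeᵇ m) g) ≡ tupleSum m (suc m) g
tupleSum-restrict-primeᵇ m g invariant = sym (begin
  tupleSum m (suc m) g
    ≡⟨ tupleSum-cong m (suc m) (λ x x∈ ∣x∣ → sym (orbit-sum x x∈ ∣x∣)) ⟩
  tupleSum m (suc m) (λ x → ∑[ k < m ] g′ (shiftDown^ m k x))
    ≡⟨ tupleSum-∑< m (suc m) m (λ k → g′ ∘ shiftDown^ m k) ⟩
  ∑[ k < m ] tupleSum m (suc m) (g′ ∘ shiftDown^ m k)
    ≡⟨ ∑<-cong m (λ k _ → tupleSum-shiftDown^ m (suc m) k g′) ⟩
  ∑[ k < m ] tupleSum m (suc m) g′
    ≡⟨ ∑<-const m _ ⟩
  m * tupleSum m (suc m) g′ ∎)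
  where
  g′ : List ℕ → ℕ
  g′ = restrict (primeᵇ m) g
  invariant^ : ∀ k x → All (InRange m) x → length x ≡ suc m → g (shiftDown^ m k x) ≡ g x
  invariant^ zero    x x∈ ∣x∣ = refl
  invariant^ (suc k) x x∈ ∣x∣ = trans (invariant (shiftDown^ m k x) (shiftDown^-InRange m k x∈)
                                                 (trans (length-shiftDown^ m k x) ∣x∣))
                                      (invariant^ k x x∈ ∣x∣)
  orbit-sum : ∀ x → All (InRange m) x → length x ≡ suc m → ∑[ k < m ] g′ (shiftDown^ m k x) ≡ g x
  orbit-sum x x∈ ∣x∣ = begin
    ∑[ k < m ] g′ (shiftDown^ m k x)
      ≡⟨ ∑<-cong m (λ k _ → term k) ⟩
    ∑[ k < m ] (𝟙 (primeᵇ m (shiftDown^ m k x)) * g x)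
      ≡⟨ ∑<-distribʳ-* m _ (g x) ⟩
    ∑[ k < m ] 𝟙 (primeᵇ m (shiftDown^ m k x)) * g x
      ≡⟨ cong (_* g x) (orbit-prime-unique m x x∈ ∣x∣) ⟩
    1 * g x
      ≡⟨ *-identityˡ (g x) ⟩
    g x ∎
    where
    term : ∀ k → g′ (shiftDown^ m k x) ≡ 𝟙 (primeᵇ m (shiftDown^ m k x)) * g x
    term k = trans (restrict-𝟙 (primeᵇ m) g _) (cong (𝟙 (primeᵇ m (shiftDown^ m k x)) *_) (invariant^ k x x∈ ∣x∣))

sum-PPF : ∀ m g →
          sum (map g (PPF (suc (suc m)))) ≡ tupleSum (suc m) (suc (suc m)) (restrict (primeᵇ (suc m)) g)
sum-PPF m g = begin
  sum (map g (PPF n))                    ≡⟨ sum-map-filter isPPF g (tuples n n) ⟩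
  tupleSum n n (restrict isPPF g)        ≡⟨ tupleSum-shrink n n _ (n≤1+n (suc m)) vanish ⟩
  tupleSum (suc m) n (restrict isPPF g)  ≡⟨ tupleSum-cong (suc m) n (λ x x∈ ∣x∣ →
                                              cong (λ b → if b then g x else 0) (isPPF≡primeᵇ (suc m) x x∈ ∣x∣)) ⟩
  tupleSum (suc m) n (restrict (primeᵇ (suc m)) g) ∎
  where
  n = suc (suc m)
  vanish : ∀ x → All (InRange n) x → length x ≡ n → Any (suc m <_) x → restrict isPPF g x ≡ 0
  vanish x x∈ ∣x∣ large with isPPF x in ppf
  ... | false = refl
  ... | true  = ⊥-elim (All¬⇒¬Any (All.map ≤⇒≯ (primeᵇ⇒≤ m x ∣x∣ prime)) large)
    where
    prime : primeᵇ (suc m) x ≡ true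
    prime = isPPF⇒primeᵇ (suc m) x (All.map proj₁ x∈) ∣x∣ ppf

tupleSum-countAdj : ∀ m (P : ℕ → ℕ → Bool) → (∀ a → ∑[ i < m ] 𝟙 (P a (suc i)) ≡ 1) →
                    ∀ k → tupleSum m (suc k) (countAdj P) ≡ k * m ^ k
tupleSum-countAdj m P unique zero    = trans (tupleSum-∷ m 0 (countAdj P)) (∑<-zero m (λ _ _ → refl))
tupleSum-countAdj m P unique (suc k) = begin
  tupleSum m (suc (suc k)) (countAdj P)                     ≡⟨ tupleSum-∷ m (suc k) _ ⟩
  ∑[ i < m ] tupleSum m (suc k) (λ y → countAdj P (suc i ∷ y)) ≡⟨ ∑<-cong m (λ i _ → starting-at (suc i)) ⟩
  ∑[ i < m ] (m ^ k + k * m ^ k)                             ≡⟨ ∑<-const m _ ⟩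
  m * (m ^ k + k * m ^ k)                                    ≡⟨ arrange m (m ^ k) k ⟩
  suc k * (m * m ^ k)                                        ∎
  where
  arrange : ∀ m p k → m * (p + k * p) ≡ suc k * (m * p)
  arrange = solve-∀
  starting-at : ∀ a → tupleSum m (suc k) (λ y → countAdj P (a ∷ y)) ≡ m ^ k + k * m ^ k
  starting-at a = begin
    tupleSum m (suc k) (λ y → countAdj P (a ∷ y))
      ≡⟨ tupleSum-∷ m k _ ⟩
    ∑[ j < m ] tupleSum m k (λ y → 𝟙 (P a (suc j)) + countAdj P (suc j ∷ y))
      ≡⟨ ∑<-cong m (λ j _ → sum-map-+ _ _ (tuples m k)) ⟩
    ∑[ j < m ] (tupleSum m k (λ _ → 𝟙 (P a (suc j))) + tupleSum m k (λ y → countAdj P (suc j ∷ y)))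
      ≡⟨ ∑<-distrib-+ m _ _ ⟩
    ∑[ j < m ] tupleSum m k (λ _ → 𝟙 (P a (suc j))) + ∑[ j < m ] tupleSum m k (λ y → countAdj P (suc j ∷ y))
      ≡⟨ cong₂ _+_ (∑<-cong m (λ j _ → tupleSum-const m k _)) (sym (tupleSum-∷ m k (countAdj P))) ⟩
    ∑[ j < m ] (𝟙 (P a (suc j)) * m ^ k) + tupleSum m (suc k) (countAdj P)
      ≡⟨ cong₂ _+_ (∑<-distribʳ-* m _ (m ^ k)) (tupleSum-countAdj m P unique k) ⟩
    ∑[ j < m ] 𝟙 (P a (suc j)) * m ^ k + k * m ^ k
      ≡⟨ cong (λ c → c * m ^ k + k * m ^ k) (unique a) ⟩
    1 * m ^ k + k * m ^ k
      ≡⟨ cong (_+ k * m ^ k) (*-identityˡ (m ^ k)) ⟩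
    m ^ k + k * m ^ k ∎

countAdj-cong : ∀ {Q : ℕ → Set} {P P′ : ℕ → ℕ → Bool} x → All Q x →
                (∀ {a b} → Q a → Q b → P a b ≡ P′ a b) →
                countAdj P x ≡ countAdj P′ x
countAdj-cong []          []               _    = refl
countAdj-cong (a ∷ [])    _                _    = refl
countAdj-cong (a ∷ b ∷ x) (qa ∷ qb ∷ qx) P≡P′ =
  cong₂ _+_ (cong 𝟙 (P≡P′ qa qb)) (countAdj-cong (b ∷ x) (qb ∷ qx) P≡P′)

countAdj-map : ∀ P (f : ℕ → ℕ) x → countAdj P (map f x) ≡ countAdj (λ a b → P (f a) (f b)) x
countAdj-map P f []          = refl
countAdj-map P f (a ∷ [])    = refl
countAdj-map P f (a ∷ b ∷ x) = cong (𝟙 (P (f a) (f b)) +_) (countAdj-map P f (b ∷ x))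

countAdj-∷ʳ : ∀ P xs y a → countAdj P (xs ∷ʳ y ∷ʳ a) ≡ countAdj P (xs ∷ʳ y) + 𝟙 (P y a)
countAdj-∷ʳ P []           y a = +-comm (𝟙 (P y a)) 0
countAdj-∷ʳ P (z ∷ [])     y a = arrange (𝟙 (P z y)) (𝟙 (P y a))
  where
  arrange : ∀ p q → p + (q + 0) ≡ (p + 0) + q
  arrange = solve-∀
countAdj-∷ʳ P (z ∷ z′ ∷ zs) y a =
  trans (cong (𝟙 (P z z′) +_) (countAdj-∷ʳ P (z′ ∷ zs) y a)) (sym (+-assoc (𝟙 (P z z′)) _ _))

countAdj-reverse : ∀ P x → countAdj P (reverse x) ≡ countAdj (λ a b → P b a) x
countAdj-reverse P []           = refl
countAdj-reverse P (a ∷ [])     = refl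
countAdj-reverse P (a ∷ y ∷ ys) = begin
  countAdj P (reverse (a ∷ y ∷ ys))         ≡⟨ cong (countAdj P) (trans (unfold-reverse a (y ∷ ys))
                                                                      (cong (_∷ʳ a) (unfold-reverse y ys))) ⟩
  countAdj P (reverse ys ∷ʳ y ∷ʳ a)         ≡⟨ countAdj-∷ʳ P (reverse ys) y a ⟩
  countAdj P (reverse ys ∷ʳ y) + 𝟙 (P y a)  ≡⟨ cong (λ z → countAdj P z + 𝟙 (P y a)) (unfold-reverse y ys) ⟨
  countAdj P (reverse (y ∷ ys)) + 𝟙 (P y a) ≡⟨ cong (_+ 𝟙 (P y a)) (countAdj-reverse P (y ∷ ys)) ⟩
  countAdj (λ a b → P b a) (y ∷ ys) + 𝟙 (P y a) ≡⟨ +-comm _ (𝟙 (P y a)) ⟩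
  countAdj (λ a b → P b a) (a ∷ y ∷ ys)     ∎

countAdj-partition : ∀ {Q : ℕ → Set} (P₁ P₂ P₃ : ℕ → ℕ → Bool) x → All Q x →
                     (∀ {a b} → Q a → Q b → 𝟙 (P₁ a b) + 𝟙 (P₂ a b) + 𝟙 (P₃ a b) ≡ 1) →
                     countAdj P₁ x + countAdj P₂ x + countAdj P₃ x ≡ length x ∸ 1
countAdj-partition P₁ P₂ P₃ []          _                _     = refl
countAdj-partition P₁ P₂ P₃ (a ∷ [])    _                _     = refl
countAdj-partition P₁ P₂ P₃ (a ∷ b ∷ x) (qa ∷ qb ∷ qx) exactly-one = begin
  (𝟙 (P₁ a b) + c₁) + (𝟙 (P₂ a b) + c₂) + (𝟙 (P₃ a b) + c₃)
    ≡⟨ arrange (𝟙 (P₁ a b)) c₁ (𝟙 (P₂ a b)) c₂ (𝟙 (P₃ a b)) c₃ ⟩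
  (𝟙 (P₁ a b) + 𝟙 (P₂ a b) + 𝟙 (P₃ a b)) + (c₁ + c₂ + c₃)
    ≡⟨ cong₂ _+_ (exactly-one qa qb) (countAdj-partition P₁ P₂ P₃ (b ∷ x) (qb ∷ qx) exactly-one) ⟩
  suc (length x) ∎
  where
  c₁ = countAdj P₁ (b ∷ x)
  c₂ = countAdj P₂ (b ∷ x)
  c₃ = countAdj P₃ (b ∷ x)
  arrange : ∀ p₁ r₁ p₂ r₂ p₃ r₃ →
            (p₁ + r₁) + (p₂ + r₂) + (p₃ + r₃) ≡ (p₁ + p₂ + p₃) + (r₁ + r₂ + r₃)
  arrange = solve-∀

-- Congruences modulo n - 1

open import Data.Nat.Divisibility using (_∣_; _∣?_; ∣⇒≤)
import Data.Nat.DivMod as DivMod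
open import Data.Integer using (ℤ; +_; 0ℤ; 1ℤ)
import Data.Integer as ℤ
import Data.Integer.Properties as ℤ
open import Data.Integer using (_⊖_)
open import Data.Integer.Divisibility.Signed
  using (divides; ∣ᵤ⇒∣; ∣⇒∣ᵤ; ∣-refl; ∣n⇒∣m*n; ∣m∣n⇒∣m+n; ∣m+n∣n⇒∣m; ∣m∣n⇒∣m-n)
  renaming (_∣_ to _∣ℤ_)
import Data.Integer.Tactic.RingSolver as ℤ-Solver

congMod-true : ∀ m u w → + m ∣ℤ u ℤ.- w → congMod m u w ≡ true
congMod-true m u w m∣ with m ∣? ℤ.∣ u ℤ.- w ∣
... | yes _  = refl
... | no m∤ = ⊥-elim (m∤ (∣⇒∣ᵤ m∣))

congMod-true⁻¹ : ∀ m u w → congMod m u w ≡ true → + m ∣ℤ u ℤ.- w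
congMod-true⁻¹ m u w eq with m ∣? ℤ.∣ u ℤ.- w ∣
congMod-true⁻¹ m u w eq | yes m∣ = ∣ᵤ⇒∣ m∣
congMod-true⁻¹ m u w () | no _

congMod-+-multiple : ∀ m u k w → congMod m (u ℤ.+ k ℤ.* + m) w ≡ congMod m u w
congMod-+-multiple m u k w = ≡-true-ext
  (λ eq → congMod-true m u w
    (∣m+n∣n⇒∣m (subst (+ m ∣ℤ_) (arrange u k (+ m) w) (congMod-true⁻¹ m (u ℤ.+ k ℤ.* + m) w eq)) m∣km))
  (λ eq → congMod-true m (u ℤ.+ k ℤ.* + m) w
    (subst (+ m ∣ℤ_) (sym (arrange u k (+ m) w)) (∣m∣n⇒∣m+n (congMod-true⁻¹ m u w eq) m∣km)))
  where
  m∣km : + m ∣ℤ k ℤ.* + m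
  m∣km = ∣n⇒∣m*n k ∣-refl
  arrange : ∀ u k m w → (u ℤ.+ k ℤ.* m) ℤ.- w ≡ (u ℤ.- w) ℤ.+ k ℤ.* m
  arrange = ℤ-Solver.solve-∀

InRange-<⇒∤ : ∀ {m b b′} → InRange m b → InRange m b′ → b < b′ → ¬ m ∣ (b′ ∸ b)
InRange-<⇒∤ (1≤b , _) (_ , b′≤m) b<b′ m∣ =
  <⇒≱ (<-≤-trans (∸-monoʳ-< 1≤b (<⇒≤ b<b′)) b′≤m) (∣⇒≤ {{>-nonZero (m<n⇒0<n∸m b<b′)}} m∣)

InRange-congruent⇒≡ : ∀ {m b b′} → InRange m b → InRange m b′ → + m ∣ℤ + b ℤ.- + b′ → b ≡ b′
InRange-congruent⇒≡ {m} {b} {b′} b∈ b′∈ m∣ = ≤-antisym (≮⇒≥ b′≮b) (≮⇒≥ b≮b′)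
  where
  m∣b⊖b′ : m ∣ ℤ.∣ b ⊖ b′ ∣
  m∣b⊖b′ = subst (λ d → m ∣ ℤ.∣ d ∣) (ℤ.m-n≡m⊖n b b′) (∣⇒∣ᵤ m∣)
  b≮b′ : ¬ b < b′
  b≮b′ b<b′ = InRange-<⇒∤ b∈ b′∈ b<b′ (subst (m ∣_) (ℤ.∣⊖∣-< b<b′) m∣b⊖b′)
  b′≮b : ¬ b′ < b
  b′≮b b′<b = InRange-<⇒∤ b′∈ b∈ b′<b
                (subst (m ∣_) (trans (ℤ.∣m⊖n∣≡∣n⊖m∣ b b′) (ℤ.∣⊖∣-< b′<b)) m∣b⊖b′)

congMod-successor-unique : ∀ m′ a ℓ → ∑[ i < suc m′ ] 𝟙 (congMod (suc m′) (+ suc i ℤ.- + a) (+ ℓ)) ≡ 1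
congMod-successor-unique m′ a ℓ =
  ∑<-𝟙-unique m (λ i → congMod m (+ suc i ℤ.- + a) (+ ℓ)) r<m (congMod-true m (+ suc r ℤ.- + a) (+ ℓ) m∣) unique
  where
  m = suc m′
  N = a + ℓ + m′
  r = N DivMod.% m
  q = N DivMod./ m
  r<m : r < m
  r<m = DivMod.m%n<n N m
  -- The successor of a is b = r + 1, where a + ℓ + m′ = q m + r; then b - a - ℓ = (1 - q) m.
  N≡ : + a ℤ.+ + ℓ ℤ.+ + m′ ≡ + r ℤ.+ + q ℤ.* (1ℤ ℤ.+ + m′)
  N≡ = trans (cong +_ (DivMod.m≡m%n+[m/n]*n N m)) (cong (λ z → + r ℤ.+ z) (ℤ.pos-* q m))
  m∣ : + m ∣ℤ (+ suc r ℤ.- + a) ℤ.- + ℓ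
  m∣ = divides (1ℤ ℤ.- + q) (begin
    (+ suc r ℤ.- + a) ℤ.- + ℓ                                 ≡⟨ arrange₁ (+ r) (+ a) (+ ℓ) (+ m′) ⟩
    (1ℤ ℤ.+ + m′) ℤ.- (+ a ℤ.+ + ℓ ℤ.+ + m′) ℤ.+ + r           ≡⟨ cong (λ z → (1ℤ ℤ.+ + m′) ℤ.- z ℤ.+ + r) N≡ ⟩
    (1ℤ ℤ.+ + m′) ℤ.- (+ r ℤ.+ + q ℤ.* (1ℤ ℤ.+ + m′)) ℤ.+ + r  ≡⟨ arrange₂ (+ r) (+ q) (+ m′) ⟩
    (1ℤ ℤ.- + q) ℤ.* (1ℤ ℤ.+ + m′)                           ∎)
    where
    arrange₁ : ∀ R A L M → ((1ℤ ℤ.+ R) ℤ.- A) ℤ.- L ≡ (1ℤ ℤ.+ M) ℤ.- (A ℤ.+ L ℤ.+ M) ℤ.+ R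
    arrange₁ = ℤ-Solver.solve-∀
    arrange₂ : ∀ R Q M → (1ℤ ℤ.+ M) ℤ.- (R ℤ.+ Q ℤ.* (1ℤ ℤ.+ M)) ℤ.+ R ≡ (1ℤ ℤ.- Q) ℤ.* (1ℤ ℤ.+ M)
    arrange₂ = ℤ-Solver.solve-∀
  unique : ∀ i → i < m → congMod m (+ suc i ℤ.- + a) (+ ℓ) ≡ true → i ≡ r
  unique i i<m eq = suc-injective (InRange-congruent⇒≡ (s≤s z≤n , i<m) (s≤s z≤n , r<m)
    (subst (+ m ∣ℤ_) (cancel (+ suc i) (+ suc r) (+ a) (+ ℓ))
           (∣m∣n⇒∣m-n (congMod-true⁻¹ m (+ suc i ℤ.- + a) (+ ℓ) eq) m∣)))
    where
    cancel : ∀ X Y A L → ((X ℤ.- A) ℤ.- L) ℤ.- ((Y ℤ.- A) ℤ.- L) ≡ X ℤ.- Y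
    cancel = ℤ-Solver.solve-∀

shiftDown-≡ : ∀ m v → 1 ≤ v → ∃[ k ] + shiftDown m v ≡ (+ v ℤ.- 1ℤ) ℤ.+ k ℤ.* + m
shiftDown-≡ m (suc zero)    _ = 1ℤ , arrange (+ m)
  where
  arrange : ∀ M → M ≡ (1ℤ ℤ.- 1ℤ) ℤ.+ 1ℤ ℤ.* M
  arrange = ℤ-Solver.solve-∀
shiftDown-≡ m (suc (suc v)) _ = 0ℤ , arrange (+ v) (+ m)
  where
  arrange : ∀ V M → 1ℤ ℤ.+ V ≡ ((1ℤ ℤ.+ (1ℤ ℤ.+ V)) ℤ.- 1ℤ) ℤ.+ 0ℤ ℤ.* M
  arrange = ℤ-Solver.solve-∀

congMod-shiftDown : ∀ m {a b} w → 1 ≤ a → 1 ≤ b →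
                    congMod m (+ shiftDown m b ℤ.- + shiftDown m a) w ≡ congMod m (+ b ℤ.- + a) w
congMod-shiftDown m {a} {b} w 1≤a 1≤b with shiftDown-≡ m a 1≤a | shiftDown-≡ m b 1≤b
... | kₐ , σa≡ | k_b , σb≡ = begin
  congMod m (+ shiftDown m b ℤ.- + shiftDown m a) w
    ≡⟨ cong (λ u → congMod m u w) (trans (cong₂ ℤ._-_ σb≡ σa≡) (arrange (+ b) (+ a) k_b kₐ (+ m))) ⟩
  congMod m ((+ b ℤ.- + a) ℤ.+ (k_b ℤ.- kₐ) ℤ.* + m) w
    ≡⟨ congMod-+-multiple m (+ b ℤ.- + a) (k_b ℤ.- kₐ) w ⟩
  congMod m (+ b ℤ.- + a) w ∎
  where
  arrange : ∀ B A K K′ M →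
            ((B ℤ.- 1ℤ) ℤ.+ K ℤ.* M) ℤ.- ((A ℤ.- 1ℤ) ℤ.+ K′ ℤ.* M) ≡ (B ℤ.- A) ℤ.+ (K ℤ.- K′) ℤ.* M
  arrange = ℤ-Solver.solve-∀

congMod-zero : ∀ {m a b} → InRange m a → InRange m b → congMod m (+ b ℤ.- + a) (+ 0) ≡ (b ≡ᵇ a)
congMod-zero {m} {a} {b} a∈ b∈ = ≡-true-ext
  (λ eq → ≡ᵇ-true (InRange-congruent⇒≡ b∈ a∈
    (subst (+ m ∣ℤ_) (ℤ.+-identityʳ _) (congMod-true⁻¹ m (+ b ℤ.- + a) (+ 0) eq))))
  (λ eq → congMod-true m (+ b ℤ.- + a) (+ 0)
    (subst (λ a → + m ∣ℤ (+ b ℤ.- + a) ℤ.- + 0) (≡ᵇ-true⁻¹ b a eq) (divides 0ℤ (arrange (+ b) (+ m)))))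
  where
  arrange : ∀ B M → (B ℤ.- B) ℤ.- 0ℤ ≡ 0ℤ ℤ.* M
  arrange = ℤ-Solver.solve-∀

trichotomy-𝟙 : ∀ {m a b} → InRange m a → InRange m b →
               𝟙 (b <ᵇ a) + 𝟙 (a <ᵇ b) + 𝟙 (congMod m (+ b ℤ.- + a) (+ 0)) ≡ 1
trichotomy-𝟙 {m} {a} {b} a∈ b∈ rewrite congMod-zero a∈ b∈ with <-cmp a b
... | tri< a<b a≢b _ rewrite <ᵇ-false {b} {a} (<⇒≤ a<b) | <ᵇ-true a<b | ≡ᵇ-false (a≢b ∘ sym) = refl
... | tri≈ _ refl _  rewrite <ᵇ-false {a} {a} ≤-refl | ≡ᵇ-true {a} refl = refl
... | tri> _ a≢b b<a rewrite <ᵇ-true b<a | <ᵇ-false {a} {b} (<⇒≤ b<a) | ≡ᵇ-false (a≢b ∘ sym) = refl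

Δmod : ℕ → ℕ → List ℕ → ℕ
Δmod m ℓ = countAdj (λ a b → congMod m (+ b ℤ.- + a) (+ ℓ))

Δ≡Δmod : ∀ m ℓ x → length x ≡ suc m → Δ ℓ x ≡ Δmod m ℓ x
Δ≡Δmod m ℓ x ∣x∣ = cong (λ L → countAdj (λ a b → congMod (L ∸ 1) (+ b ℤ.- + a) (+ ℓ)) x) ∣x∣

Δmod-shiftInvariant : ∀ m ℓ → ShiftInvariant m (Δmod m ℓ)
Δmod-shiftInvariant m ℓ x x∈ _ = trans (countAdj-map _ (shiftDown m) x)
  (countAdj-cong x x∈ (λ (1≤a , _) (1≤b , _) → congMod-shiftDown m (+ ℓ) 1≤a 1≤b))

des+asc+Δmod₀ : ∀ m x → All (InRange m) x → des x + asc x + Δmod m 0 x ≡ length x ∸ 1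
des+asc+Δmod₀ m x x∈ = countAdj-partition _ _ _ x x∈ trichotomy-𝟙

open import Data.Rational using (1ℚ; _/_)
import Data.Rational.Properties as ℚ
import Data.Rational.Unnormalised as ℚᵘ

𝔼-≡ : ∀ {A : Set} (xs : List A) (f : A → ℕ) k d → 0 < length xs →
      suc d * sum (map f xs) ≡ k * length xs → 𝔼 xs f ≡ (+ k) / suc d
𝔼-≡ (x ∷ xs) f k d _ eq = ℚ.fromℚᵘ-cong {ℚᵘ.mkℚᵘ (+ s) (length xs)} {ℚᵘ.mkℚᵘ (+ k) d}
  (ℚᵘ.*≡* (begin
    + s ℤ.* + suc d              ≡⟨ ℤ.pos-* s (suc d) ⟨
    + (s * suc d)                ≡⟨ cong +_ (trans (*-comm s (suc d)) eq) ⟩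
    + (k * suc (length xs))      ≡⟨ ℤ.pos-* k (suc (length xs)) ⟩
    + k ℤ.* + suc (length xs)    ∎))
  where
  s = sum (map f (x ∷ xs))

module PPF-Sums (m′ : ℕ) where

  m = suc m′
  n = suc m

  sum-PPF-cong : ∀ {f g} → (∀ x → All (InRange m) x → length x ≡ n → f x ≡ g x) →
                 sum (map f (PPF n)) ≡ sum (map g (PPF n))
  sum-PPF-cong {f} {g} f≡g = begin
    sum (map f (PPF n))                   ≡⟨ sum-PPF m′ f ⟩
    tupleSum m n (restrict (primeᵇ m) f)  ≡⟨ tupleSum-cong m n (λ x x∈ ∣x∣ →
                                               cong (λ v → if primeᵇ m x then v else 0) (f≡g x x∈ ∣x∣)) ⟩
    tupleSum m n (restrict (primeᵇ m) g)  ≡⟨ sum-PPF m′ g ⟨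
    sum (map g (PPF n))                   ∎

  m*sum-PPF : ∀ g → ShiftInvariant m g → m * sum (map g (PPF n)) ≡ tupleSum m n g
  m*sum-PPF g invariant = trans (cong (m *_) (sum-PPF m′ g)) (tupleSum-restrict-primeᵇ m g invariant)

  length-PPF : length (PPF n) ≡ m ^ m
  length-PPF = *-cancelˡ-≡ _ _ m (begin
    m * length (PPF n)                 ≡⟨ cong (m *_) (trans (sym (*-identityˡ _)) (sym (sum-map-const 1 (PPF n)))) ⟩
    m * sum (map (λ _ → 1) (PPF n))    ≡⟨ m*sum-PPF (λ _ → 1) (λ _ _ _ → refl) ⟩
    tupleSum m n (λ _ → 1)             ≡⟨ tupleSum-const m n 1 ⟩
    1 * m ^ n                          ≡⟨ *-identityˡ (m ^ n) ⟩
    m * m ^ m                          ∎)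

  sum-Δ-PPF : ∀ ℓ → sum (map (Δ ℓ) (PPF n)) ≡ length (PPF n)
  sum-Δ-PPF ℓ = *-cancelˡ-≡ _ _ m (begin
    m * sum (map (Δ ℓ) (PPF n))        ≡⟨ cong (m *_) (sum-PPF-cong (λ x _ ∣x∣ → Δ≡Δmod m ℓ x ∣x∣)) ⟩
    m * sum (map (Δmod m ℓ) (PPF n))   ≡⟨ m*sum-PPF (Δmod m ℓ) (Δmod-shiftInvariant m ℓ) ⟩
    tupleSum m n (Δmod m ℓ)            ≡⟨ tupleSum-countAdj m _ (λ a → congMod-successor-unique m′ a ℓ) m ⟩
    m * m ^ m                          ≡⟨ cong (m *_) length-PPF ⟨
    m * length (PPF n)                 ∎)

  sum-des≡sum-asc : sum (map des (PPF n)) ≡ sum (map asc (PPF n))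
  sum-des≡sum-asc = begin
    sum (map des (PPF n))                              ≡⟨ sum-PPF m′ des ⟩
    tupleSum m n (restrict (primeᵇ m) des)             ≡⟨ tupleSum-reverse m n _ ⟨
    tupleSum m n (restrict (primeᵇ m) des ∘ reverse)   ≡⟨ tupleSum-cong m n (λ x _ _ →
                                                            cong₂ (λ b v → if b then v else 0) (primeᵇ-reverse m x)
                                                                  (countAdj-reverse (λ a b → b <ᵇ a) x)) ⟩
    tupleSum m n (restrict (primeᵇ m) asc)             ≡⟨ sum-PPF m′ asc ⟨
    sum (map asc (PPF n))                              ∎

  -- Every adjacent pair is a descent, an ascent or a 0-difference, and the last kind has mean 1.
  2*sum-des-PPF : 2 * sum (map des (PPF n)) ≡ m′ * length (PPF n)
  2*sum-des-PPF = +-cancelʳ-≡ L _ _ (begin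
    2 * D + L
      ≡⟨ arrange D L ⟩
    D + D + L
      ≡⟨ cong₂ (λ a b → D + a + b) sum-des≡sum-asc (sym (sum-Δ-PPF 0)) ⟩
    D + sum (map asc (PPF n)) + sum (map (Δ 0) (PPF n))
      ≡⟨ cong (λ a → a + sum (map (Δ 0) (PPF n))) (sum-map-+ des asc (PPF n)) ⟨
    sum (map (λ x → des x + asc x) (PPF n)) + sum (map (Δ 0) (PPF n))
      ≡⟨ sum-map-+ (λ x → des x + asc x) (Δ 0) (PPF n) ⟨
    sum (map (λ x → des x + asc x + Δ 0 x) (PPF n))
      ≡⟨ sum-PPF-cong adjacent-pairs ⟩
    sum (map (λ _ → m) (PPF n))
      ≡⟨ sum-map-const m (PPF n) ⟩
    m * L
      ≡⟨ +-comm L (m′ * L) ⟩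
    m′ * L + L ∎)
    where
    D = sum (map des (PPF n))
    L = length (PPF n)
    arrange : ∀ d l → 2 * d + l ≡ d + d + l
    arrange = solve-∀
    adjacent-pairs : ∀ x → All (InRange m) x → length x ≡ n → des x + asc x + Δ 0 x ≡ m
    adjacent-pairs x x∈ ∣x∣ = begin
      des x + asc x + Δ 0 x        ≡⟨ cong (λ d → des x + asc x + d) (Δ≡Δmod m 0 x ∣x∣) ⟩
      des x + asc x + Δmod m 0 x   ≡⟨ des+asc+Δmod₀ m x x∈ ⟩
      length x ∸ 1                 ≡⟨ cong (_∸ 1) ∣x∣ ⟩
      m                            ∎

  2*sum-asc-PPF : 2 * sum (map asc (PPF n)) ≡ m′ * length (PPF n)
  2*sum-asc-PPF = trans (cong (2 *_) (sym sum-des≡sum-asc)) 2*sum-des-PPF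

corollary5p1 : (n : ℕ) → 2 ≤ n →
    ((ℓ : ℕ) → ℓ ≤ n ∸ 2 → 𝔼 (PPF n) (Δ ℓ) ≡ 1ℚ)
    × (𝔼 (PPF n) des ≡ (+ (n ∸ 2)) / 2)
    × (𝔼 (PPF n) asc ≡ (+ (n ∸ 2)) / 2)
corollary5p1 (suc zero)     (s≤s ())
corollary5p1 (suc (suc m′)) _ =
    (λ ℓ _ → 𝔼-≡ (PPF n) (Δ ℓ) 1 0 nonempty (cong (1 *_) (sum-Δ-PPF ℓ)))
  , 𝔼-≡ (PPF n) des m′ 1 nonempty 2*sum-des-PPF
  , 𝔼-≡ (PPF n) asc m′ 1 nonempty 2*sum-asc-PPF
  where
  open PPF-Sums m′
  nonempty : 0 < length (PPF n)
  nonempty = subst (0 <_) (sym length-PPF) (m^n>0 m m)
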